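{- Let $d,r\geq1$ and $1\leq i\leq d$. For $A\in\mathcal{A}(r\Delta_{i,d})$ let $\mathrm{comp}'(A)$ and $\sigma'_A$ be as defined below. Then the map $$\mathrm{pair}_i:\mathcal{A}(r\Delta_{i,d})\to\bigcup_{j=1}^d\mathfrak{C}(r-1,d+1,ir-j)\times\mathfrak{A}(d,j),\qquad\mathrm{pair}_i(A)=(\mathrm{comp}'(A),\sigma'_A),$$ is a bijection.
   Context: $r\Delta_{i,d}=\{x\in\mathbb{R}^{d+1}:0\leq x_k\leq r,\ \sum_kx_k=ir\}$. Its alcoves are the maximal simplices of the subdivision by the hyperplanes $x_{a+1}+\dots+x_b=m$ ($0\leq a<b\leq d+1$, $m\in\mathbb{Z}$), identified with vertex sets $A=\{\vec a_1,\dots,\vec a_{d+1}\}\subset\mathbb{N}^{d+1}$. $\mathrm{comp}'(A)=(c_1,\dots,c_{d+1})$ with $c_k=\min_{\vec v\in A}v_k$. For $\vec a$ with coordinate sum $ir$, $I_{\vec a}$ is the $ir$-multiset of $[d+1]$ with $a_t$ copies of $t$, written $\{I_1\leq\dots\leq I_{ir}\}$. The vertices are ordered so the multisets are sorted: $I_{11}\leq I_{21}\leq\dots\leq I_{(d+1)1}\leq I_{12}\leq\dots\leq I_{(d+1)(ir)}$, where row $a$ is $I_{\vec a_a}=\{I_{a1}\leq\dots\leq I_{a(ir)}\}$. The decorated matrix is the $(d+1)\times ir$ grid with these rows where the edge between $(a,b)$ and $(a+1,b)$ is marked iff $I_{ab}<I_{(a+1)b}$; there is exactly one mark between rows $a$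 and $a+1$ for each $1\leq a\leq d$ and no other marks. $\sigma'_A$ is the permutation of $[d]$ whose one-line notation lists, for the marks read in order (columns left to right, within a column top to bottom), the index $a$ such that the mark lies between rows $a$ and $a+1$. $\mathfrak{C}(m,n,s)=\{(c_1,\dots,c_n)\in\mathbb{N}^n:\sum c_k=s,\ c_k\leq m\}$; $\mathfrak{A}(d,j)$ is the set of permutations of $[d]$ with exactly $j-1$ descents. -}

module Defs where

open import Data.Nat using (ℕ; zero; suc; _+_; _*_; _∸_; _≤_; _<_; _<ᵇ_; _⊓_)
open import Data.Nat.ListAction as NL using ()
open import Data.Bool using (Bool; true; false; if_then_else_)
open import Data.List as L using (List; []; _∷_; _++_; replicate; upTo; concatMap; take)
open import Data.Vec as V using (Vec; lookup; tabulate; toList; foldr₁)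
open import Data.Vec.Relation.Unary.All using (All)
open import Data.Fin using (Fin)
open import Data.Product using (Σ; _×_; _,_)
open import Data.List.Relation.Binary.Permutation.Propositional using (_↭_)
open import Relation.Binary.PropositionalEquality using (_≡_; _≢_)
open import Relation.Nullary using (¬_)

-- A lattice point of R^{d+1} is a vector of naturals; an alcove candidate is a
-- (d+1)-tuple of such points, row a = vertex a (0-based indices throughout).
Point : ℕ → Set
Point d = Vec ℕ (suc d)

Config : ℕ → Set
Config d = Vec (Point d) (suc d)

at : {A : Set} → A → List A → ℕ → A
at x₀ []       _       = x₀
at x₀ (x ∷ xs) zero    = x
at x₀ (x ∷ xs) (suc n) = at x₀ xs n

-- the multiset I_v as a weakly increasing list: a_t copies of t
-- (coordinates are labelled 0,…,d instead of 1,…,d+1; only the order matters)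
multisetFrom : ℕ → List ℕ → List ℕ
multisetFrom t []       = []
multisetFrom t (x ∷ xs) = replicate x t ++ multisetFrom (suc t) xs

multiset : ∀ {d} → Point d → List ℕ
multiset v = multisetFrom 0 (toList v)

-- entry I_{ab} of the decorated matrix (row a, column b, both 0-based)
entry : ∀ {d} → Config d → ℕ → ℕ → ℕ
entry A a b = at 0 (at [] (L.map multiset (toList A)) a) b

InHypersimplex : (d r i : ℕ) → Point d → Set
InHypersimplex d r i v = All (_≤ r) v × V.sum v ≡ i * r

prefixSum : ∀ {d} → Point d → ℕ → ℕ
prefixSum v t = NL.sum (take t (toList v))

segSum : ∀ {d} → Point d → ℕ → ℕ → ℕ
segSum v a b = prefixSum v b ∸ prefixSum v a

-- The vertex set of a maximal simplex of the subdivision of rΔ_{i,d} by the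
-- hyperplanes x_{a+1}+…+x_b = m: d+1 distinct lattice points of rΔ_{i,d}
-- such that no hyperplane x_{a+1}+…+x_b = m (m ∈ ℤ) meets the interior of
-- their convex hull, i.e. each L_{ab} takes values in some {m, m+1} on them.
IsAlcoveVertexSet : (d r i : ℕ) → Config d → Set
IsAlcoveVertexSet d r i A =
    (∀ (k : Fin (suc d)) → InHypersimplex d r i (lookup A k))
  × (∀ (k l : Fin (suc d)) → k ≢ l → lookup A k ≢ lookup A l)
  × (∀ (a b : ℕ) → a < b → b ≤ suc d → ∀ (k l : Fin (suc d)) →
        segSum (lookup A k) a b ≤ segSum (lookup A l) a b + 1)

-- the ordering convention of the paper:
-- I_{11} ≤ I_{21} ≤ … ≤ I_{(d+1)1} ≤ I_{12} ≤ … ≤ I_{(d+1)(ir)}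
IsSorted : (d r i : ℕ) → Config d → Set
IsSorted d r i A =
    (∀ (a b : ℕ) → a < d → b < i * r → entry A a b ≤ entry A (suc a) b)
  × (∀ (b : ℕ) → suc b < i * r → entry A d b ≤ entry A 0 (suc b))

-- An alcove A ∈ 𝒜(rΔ_{i,d}), represented by its vertex set listed in the
-- paper's (sorted) order.
IsAlcove : (d r i : ℕ) → Config d → Set
IsAlcove d r i A = IsAlcoveVertexSet d r i A × IsSorted d r i A

comp′ : ∀ {d} → Config d → Vec ℕ (suc d)
comp′ A = tabulate λ k → foldr₁ _⊓_ (V.map (λ v → lookup v k) A)

-- σ'_A: read the marks column by column (left to right), within a column top
-- to bottom; a mark between rows a and a+1 (1-based) contributes the letter a.
marksInColumn : ∀ {d} → Config d → ℕ → List ℕ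
marksInColumn {d} A b =
  concatMap (λ a → if entry A a b <ᵇ entry A (suc a) b then suc a ∷ [] else []) (upTo d)

σ′ : (d r i : ℕ) → Config d → List ℕ
σ′ d r i A = concatMap (marksInColumn A) (upTo (i * r))

pair : (d r i : ℕ) → Config d → Vec ℕ (suc d) × List ℕ
pair d r i A = comp′ A , σ′ d r i A

des : List ℕ → ℕ
des []           = 0
des (x ∷ [])     = 0
des (x ∷ y ∷ xs) = (if y <ᵇ x then 1 else 0) + des (y ∷ xs)

InC : ∀ {n} → (m s : ℕ) → Vec ℕ n → Set
InC m s c = All (_≤ m) c × V.sum c ≡ s

-- σ ∈ 𝔄(d, j): σ is a permutation of [d] = {1,…,d} (one-line notation)
-- with exactly j-1 descents (stated as des σ + 1 ≡ j; used only for j ≥ 1)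
InA : (d j : ℕ) → List ℕ → Set
InA d j σ = (σ ↭ L.map suc (upTo d)) × des σ + 1 ≡ j

-- (c, σ) ∈ ⋃_{j=1}^d 𝔆(r-1, d+1, ir-j) × 𝔄(d, j)
-- (ir - j is an integer possibly < 0, so "sum c = ir - j" is written sum c + j = ir)
InCodomain : (d r i : ℕ) → Vec ℕ (suc d) × List ℕ → Set
InCodomain d r i (c , σ) =
  Σ ℕ λ j → 1 ≤ j × j ≤ d
          × (All (_≤ r ∸ 1) c × V.sum c + j ≡ i * r)
          × InA d j σ

module Submission where

-- Write F a t for the t-th prefix sum of vertex a. Since I_v has its b-th entry below u iff
-- b < F_v(u), the sorting convention says exactly that every column t satisfies
-- F 0 t ≥ F 1 t ≥ … ≥ F d t ≥ F 0 t − 1, i.e. F a t = Q t + [a < S t] for a staircase (Q, S)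
-- with S t ∈ [0, d]; distinctness of the vertices forces S to permute {1, …, d}, and every such
-- staircase is conversely an alcove. The mark between rows a and a+1 sits in column Q t where
-- S t = a+1, and (Q t, S t) increases lexicographically in t, so σ'_A = (S 1, …, S d). Column k
-- of A takes only the values g_k and g_k + 1, where g_k = Q(k+1) − Q k − [S(k+1) < S k], and
-- both occur; hence comp'(A) = g, and telescoping Q gives |comp'(A)| + des σ'_A + 1 = ir.
-- As (comp'(A), σ'_A) determines (Q, S), pair is injective, and the staircase built from any
-- (c, σ) in the codomain is an alcove mapped to (c, σ).

open import Defs

open import Data.Bool using (Bool; true; false; if_then_else_; T)
open import Data.Empty using (⊥-elim)
open import Data.Fin as Fin using (Fin; toℕ)
import Data.Fin.Properties as FinP
open import Data.List as L using (List; []; _∷_; upTo; concatMap; take; length)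
import Data.List.Properties as LP
open import Data.List.Membership.Propositional using (_∈_; find; lose)
open import Data.List.Membership.Propositional.Properties
  using (∈-concatMap⁺; ∈-concatMap⁻; ∈-upTo⁺; ∈-upTo⁻; ∈-applyUpTo⁺; ∈-applyUpTo⁻; ∈-map⁺; ∈-map⁻)
open import Data.List.Membership.Propositional.Properties.WithK using (unique∧set⇒bag)
open import Data.List.Relation.Binary.BagAndSetEquality using (∼bag⇒↭)
open import Data.List.Relation.Binary.Permutation.Propositional using (_↭_; ↭-sym)
import Data.List.Relation.Binary.Permutation.Propositional.Properties as PermP
open import Data.List.Relation.Unary.All as LAll using ([]; _∷_)
import Data.List.Relation.Unary.All.Properties as LAllP
open import Data.List.Relation.Unary.AllPairs as AP using (AllPairs; []; _∷_)
import Data.List.Relation.Unary.AllPairs.Properties as APP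
open import Data.List.Relation.Unary.Any using (here; there)
open import Data.List.Relation.Unary.Unique.Propositional using (Unique)
import Data.List.Relation.Unary.Unique.Propositional.Properties as UniqP
open import Data.Nat
open import Data.Nat.ListAction as NL using ()
open import Data.Nat.Properties
open import Data.Nat.Tactic.RingSolver using (solve-∀)
open import Data.Product
open import Data.Product.Relation.Binary.Lex.Strict using (×-strictPartialOrder)
open import Data.Sum using (inj₁; inj₂)
open import Data.Vec as V using (Vec; lookup; tabulate; toList; foldr₁)
import Data.Vec.Properties as VP
open import Data.Vec.Relation.Unary.All using (All)
import Data.Vec.Relation.Unary.All.Properties as VAllP
open import Function using (_∘_; case_of_)
open import Function.Bundles using (mk⇔)
open import Level using (0ℓ)
open import Relation.Binary.Bundles using (StrictPartialOrder)
open import Relation.Binary.Definitions using (tri<; tri≈; tri>)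
open import Relation.Binary.PropositionalEquality
open import Relation.Nullary using (yes; no; ¬_; contradiction)
open import Algebra.Properties.CommutativeSemigroup +-commutativeSemigroup using (interchange)

𝟙[_<_] : ℕ → ℕ → ℕ
𝟙[ a < s ] = if a <ᵇ s then 1 else 0

𝟙[<]≤1 : ∀ a s → 𝟙[ a < s ] ≤ 1
𝟙[<]≤1 a       zero    = z≤n
𝟙[<]≤1 zero    (suc s) = ≤-refl
𝟙[<]≤1 (suc a) (suc s) = 𝟙[<]≤1 a s

𝟙[<]-of-< : ∀ {a s} → a < s → 𝟙[ a < s ] ≡ 1
𝟙[<]-of-< {zero}  {suc s} _         = refl
𝟙[<]-of-< {suc a} {suc s} (s≤s a<s) = 𝟙[<]-of-< a<s

𝟙[<]-of-≥ : ∀ {a s} → s ≤ a → 𝟙[ a < s ] ≡ 0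
𝟙[<]-of-≥ {a}     {zero}  _         = refl
𝟙[<]-of-≥ {suc a} {suc s} (s≤s s≤a) = 𝟙[<]-of-≥ s≤a

𝟙[<]-irrefl : ∀ a → 𝟙[ a < a ] ≡ 0
𝟙[<]-irrefl a = 𝟙[<]-of-≥ {a} ≤-refl

𝟙[<]≡1⇒< : ∀ {a s} → 𝟙[ a < s ] ≡ 1 → a < s
𝟙[<]≡1⇒< {a} {s} e with a <? s
... | yes a<s = a<s
... | no a≮s = contradiction (trans (sym (𝟙[<]-of-≥ (≮⇒≥ a≮s))) e) 0≢1+n

𝟙[<]≡0⇒≥ : ∀ {a s} → 𝟙[ a < s ] ≡ 0 → s ≤ a
𝟙[<]≡0⇒≥ {a} {s} e with a <? s
... | yes a<s = ⊥-elim (0≢1+n (trans (sym e) (𝟙[<]-of-< a<s)))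
... | no a≮s = ≮⇒≥ a≮s

𝟙[<]-antitone : ∀ a s → 𝟙[ suc a < s ] ≤ 𝟙[ a < s ]
𝟙[<]-antitone a       zero    = z≤n
𝟙[<]-antitone zero    (suc s) = 𝟙[<]≤1 0 s
𝟙[<]-antitone (suc a) (suc s) = 𝟙[<]-antitone a s

𝟙[<]-step : ∀ a s → s ≢ suc a → 𝟙[ a < s ] ≡ 𝟙[ suc a < s ]
𝟙[<]-step a       zero          _  = refl
𝟙[<]-step zero    (suc zero)    ne = ⊥-elim (ne refl)
𝟙[<]-step zero    (suc (suc s)) _  = refl
𝟙[<]-step (suc a) (suc s)       ne = 𝟙[<]-step a s (ne ∘ cong suc)

𝟙[<]-subadditive : ∀ a b c → 𝟙[ a < c ] ≤ 𝟙[ b < c ] + 𝟙[ a < b ]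
𝟙[<]-subadditive a b c with a <? c | b <? c
... | no a≮c  | _ rewrite 𝟙[<]-of-≥ (≮⇒≥ a≮c) = z≤n
... | yes a<c | yes b<c rewrite 𝟙[<]-of-< a<c | 𝟙[<]-of-< b<c = s≤s z≤n
... | yes a<c | no b≮c
  rewrite 𝟙[<]-of-< a<c | 𝟙[<]-of-< (<-≤-trans a<c (≮⇒≥ b≮c)) = m≤n+m 1 _

𝟙[<]-transitive : ∀ a b c → 𝟙[ b < c ] + 𝟙[ a < b ] ≤ 1 + 𝟙[ a < c ]
𝟙[<]-transitive a b c with b <? c | a <? b
... | no b≮c  | _ rewrite 𝟙[<]-of-≥ (≮⇒≥ b≮c) = ≤-trans (𝟙[<]≤1 a b) (m≤m+n 1 _)
... | yes b<c | no a≮b rewrite 𝟙[<]-of-< b<c | 𝟙[<]-of-≥ (≮⇒≥ a≮b) = m≤m+n 1 _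
... | yes b<c | yes a<b
  rewrite 𝟙[<]-of-< b<c | 𝟙[<]-of-< a<b | 𝟙[<]-of-< (<-trans a<b b<c) = ≤-refl

𝟙[<]-exchange : ∀ x y s t → 𝟙[ x < t ] + 𝟙[ y < s ] ≤ 𝟙[ y < t ] + 𝟙[ x < s ] + 1
𝟙[<]-exchange x y s t with x <? t | y <? s
... | no x≮t | _ rewrite 𝟙[<]-of-≥ (≮⇒≥ x≮t) = ≤-trans (𝟙[<]≤1 y s) (m≤n+m 1 _)
... | yes _  | no y≮s rewrite 𝟙[<]-of-≥ (≮⇒≥ y≮s) | +-identityʳ 𝟙[ x < t ] =
  ≤-trans (𝟙[<]≤1 x t) (m≤n+m 1 _)
... | yes x<t | yes y<s rewrite 𝟙[<]-of-< x<t | 𝟙[<]-of-< y<s with y <? t | x <? s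
...   | yes y<t | _ rewrite 𝟙[<]-of-< y<t = s≤s (m≤n+m 1 _)
...   | no _ | yes x<s rewrite 𝟙[<]-of-< x<s = +-monoˡ-≤ 1 (m≤n+m 1 _)
...   | no y≮t | no x≮s =
  ⊥-elim (<-irrefl refl (<-≤-trans x<t (≤-trans (≮⇒≥ y≮t) (<⇒≤ (<-≤-trans y<s (≮⇒≥ x≮s))))))

sumUpTo : (ℕ → ℕ) → ℕ → ℕ
sumUpTo h zero    = 0
sumUpTo h (suc k) = h 0 + sumUpTo (λ j → h (suc j)) k

sumUpTo-vanishing : ∀ h k → (∀ j → j < k → h j ≡ 0) → sumUpTo h k ≡ 0
sumUpTo-vanishing h zero    _  = refl
sumUpTo-vanishing h (suc k) h0 rewrite h0 0 z<s =
  sumUpTo-vanishing (λ j → h (suc j)) k (λ j j<k → h0 (suc j) (s≤s j<k))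

sumUpTo-+ : ∀ f g k → sumUpTo (λ j → f j + g j) k ≡ sumUpTo f k + sumUpTo g k
sumUpTo-+ f g zero    = refl
sumUpTo-+ f g (suc k) =
  trans (cong (f 0 + g 0 +_) (sumUpTo-+ (λ j → f (suc j)) (λ j → g (suc j)) k))
        (interchange (f 0) (g 0) _ _)

telescope : ∀ g h k → (∀ j → j < k → g (suc j) ≡ g j + h j) → g k ≡ g 0 + sumUpTo h k
telescope g h zero    _    = sym (+-identityʳ _)
telescope g h (suc k) step = begin
  g (suc k)
    ≡⟨ telescope (λ j → g (suc j)) (λ j → h (suc j)) k (λ j j<k → step (suc j) (s≤s j<k)) ⟩
  g 1 + sumUpTo (λ j → h (suc j)) k          ≡⟨ cong (_+ sumUpTo (λ j → h (suc j)) k) (step 0 z<s) ⟩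
  g 0 + h 0 + sumUpTo (λ j → h (suc j)) k    ≡⟨ +-assoc (g 0) (h 0) _ ⟩
  g 0 + sumUpTo h (suc k)                    ∎
  where open ≡-Reasoning

sum-tabulate : ∀ m (f : ℕ → ℕ) → V.sum (tabulate {n = m} (λ k → f (toℕ k))) ≡ sumUpTo f m
sum-tabulate zero    f = refl
sum-tabulate (suc m) f = cong (f 0 +_) (sum-tabulate m (λ k → f (suc k)))

sum-toList : ∀ {n} (v : Vec ℕ n) → V.sum v ≡ NL.sum (toList v)
sum-toList V.[]       = refl
sum-toList (x V.∷ v) = cong (x +_) (sum-toList v)

module _ {X : Set} (x₀ : X) where

  at-applyUpTo : ∀ f n k → k < n → at x₀ (L.applyUpTo f n) k ≡ f k
  at-applyUpTo f (suc n) zero    _         = refl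
  at-applyUpTo f (suc n) (suc k) (s≤s k<n) = at-applyUpTo (λ j → f (suc j)) n k k<n

  applyUpTo-at : ∀ xs → L.applyUpTo (at x₀ xs) (length xs) ≡ xs
  applyUpTo-at []       = refl
  applyUpTo-at (x ∷ xs) = cong (x ∷_) (applyUpTo-at xs)

  at-beyond : ∀ xs k → length xs ≤ k → at x₀ xs k ≡ x₀
  at-beyond []       k       _         = refl
  at-beyond (x ∷ xs) (suc k) (s≤s l≤k) = at-beyond xs k l≤k

  at-∈ : ∀ xs k → k < length xs → at x₀ xs k ∈ xs
  at-∈ (x ∷ xs) zero    _         = here refl
  at-∈ (x ∷ xs) (suc k) (s≤s k<l) = there (at-∈ xs k k<l)

  ∈⇒at : ∀ {x} xs → x ∈ xs → Σ ℕ λ k → k < length xs × at x₀ xs k ≡ x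
  ∈⇒at (y ∷ xs) (here refl) = 0 , z<s , refl
  ∈⇒at (y ∷ xs) (there x∈xs) with ∈⇒at xs x∈xs
  ... | k , k<l , e = suc k , s≤s k<l , e

  at-extensionality : ∀ xs ys → length xs ≡ length ys →
                      (∀ k → k < length xs → at x₀ xs k ≡ at x₀ ys k) → xs ≡ ys
  at-extensionality []       []       _ _  = refl
  at-extensionality (x ∷ xs) (y ∷ ys) l e =
    cong₂ _∷_ (e 0 z<s) (at-extensionality xs ys (suc-injective l) (λ k k<l → e (suc k) (s≤s k<l)))

  lookup-at : ∀ {n} (v : Vec X n) k → lookup v k ≡ at x₀ (toList v) (toℕ k)
  lookup-at (x V.∷ v) Fin.zero    = refl
  lookup-at (x V.∷ v) (Fin.suc k) = lookup-at v k

-- Prefix sums and the multisets I_v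

sum-take-suc : ∀ xs k → NL.sum (take (suc k) xs) ≡ NL.sum (take k xs) + at 0 xs k
sum-take-suc []       zero    = refl
sum-take-suc []       (suc k) = refl
sum-take-suc (x ∷ xs) zero    = +-identityʳ x
sum-take-suc (x ∷ xs) (suc k) = trans (cong (x +_) (sum-take-suc xs k)) (sym (+-assoc x _ _))

sum-take-mono : ∀ xs {t u} → t ≤ u → NL.sum (take t xs) ≤ NL.sum (take u xs)
sum-take-mono xs       z≤n       = z≤n
sum-take-mono []       (s≤s _)   = z≤n
sum-take-mono (x ∷ xs) (s≤s t≤u) = +-monoʳ-≤ x (sum-take-mono xs t≤u)

sum-take-≤ : ∀ xs t → NL.sum (take t xs) ≤ NL.sum xs
sum-take-≤ []       zero    = z≤n
sum-take-≤ []       (suc t) = z≤n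
sum-take-≤ (x ∷ xs) zero    = z≤n
sum-take-≤ (x ∷ xs) (suc t) = +-monoʳ-≤ x (sum-take-≤ xs t)

sum-take-all : ∀ xs t → length xs ≤ t → NL.sum (take t xs) ≡ NL.sum xs
sum-take-all xs t l≤t = cong NL.sum (LP.take-all t xs l≤t)

sum-take-injective : ∀ xs ys → length xs ≡ length ys →
                     (∀ t → NL.sum (take t xs) ≡ NL.sum (take t ys)) → xs ≡ ys
sum-take-injective []       []       _ _ = refl
sum-take-injective (x ∷ xs) (y ∷ ys) l e = cong₂ _∷_ x≡y
  (sum-take-injective xs ys (suc-injective l) λ t → +-cancelˡ-≡ x _ _ (trans (e (suc t)) (cong (_+ _) (sym x≡y))))
  where
  x≡y : x ≡ y
  x≡y = trans (sym (+-identityʳ x)) (trans (e 1) (+-identityʳ y))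

sum-take-tabulate : ∀ m (f : ℕ → ℕ) t → t ≤ m →
                    NL.sum (take t (toList (tabulate {n = m} (λ k → f (toℕ k))))) ≡ sumUpTo f t
sum-take-tabulate m       f zero    _         = refl
sum-take-tabulate (suc m) f (suc t) (s≤s t≤m) = cong (f 0 +_) (sum-take-tabulate m (λ k → f (suc k)) t t≤m)

sum-take-sumUpTo : ∀ xs t → NL.sum (take t xs) ≡ sumUpTo (at 0 xs) t
sum-take-sumUpTo []       zero    = refl
sum-take-sumUpTo []       (suc t) = sym (sumUpTo-vanishing (at 0 []) (suc t) (λ _ _ → refl))
sum-take-sumUpTo (x ∷ xs) zero    = refl
sum-take-sumUpTo (x ∷ xs) (suc t) = cong (x +_) (sum-take-sumUpTo xs t)

<sum-take⇒multiset-at< : ∀ xs t₀ u b → b < NL.sum (take u xs) → at 0 (multisetFrom t₀ xs) b < t₀ + u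
<sum-take⇒multiset-at< (zero ∷ xs)  t₀ (suc u) b lt =
  subst (at 0 (multisetFrom (suc t₀) xs) b <_) (sym (+-suc t₀ u)) (<sum-take⇒multiset-at< xs (suc t₀) u b lt)
<sum-take⇒multiset-at< (suc x ∷ xs) t₀ (suc u) zero    _        = m<m+n t₀ z<s
<sum-take⇒multiset-at< (suc x ∷ xs) t₀ (suc u) (suc b) (s≤s lt) = <sum-take⇒multiset-at< (x ∷ xs) t₀ (suc u) b lt

multiset-at<⇒<sum-take : ∀ xs t₀ u b → b < NL.sum xs → at 0 (multisetFrom t₀ xs) b < t₀ + u →
                         b < NL.sum (take u xs)
multiset-at<⇒<sum-take (zero ∷ xs) t₀ zero b b<n lt =
  multiset-at<⇒<sum-take xs (suc t₀) zero b b<n (≤-trans lt (+-monoˡ-≤ 0 (n≤1+n t₀)))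
multiset-at<⇒<sum-take (zero ∷ xs) t₀ (suc u) b b<n lt =
  multiset-at<⇒<sum-take xs (suc t₀) u b b<n (subst (at 0 (multisetFrom (suc t₀) xs) b <_) (+-suc t₀ u) lt)
multiset-at<⇒<sum-take (suc x ∷ xs) t₀ zero    zero    _         lt = ⊥-elim (<-irrefl (sym (+-identityʳ t₀)) lt)
multiset-at<⇒<sum-take (suc x ∷ xs) t₀ (suc u) zero    _         _  = s≤s z≤n
multiset-at<⇒<sum-take (suc x ∷ xs) t₀ zero    (suc b) (s≤s b<n) lt =
  ⊥-elim (n≮0 (multiset-at<⇒<sum-take (x ∷ xs) t₀ zero b b<n lt))
multiset-at<⇒<sum-take (suc x ∷ xs) t₀ (suc u) (suc b) (s≤s b<n) lt =
  s≤s (multiset-at<⇒<sum-take (x ∷ xs) t₀ (suc u) b b<n lt)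

row : ∀ {d} → Config d → ℕ → Point d
row {d} A a = at (V.replicate (suc d) 0) (toList A) a

prefix : ∀ {d} → Config d → ℕ → ℕ → ℕ
prefix A a t = prefixSum (row A a) t

HasRowSums : ∀ {d} → Config d → ℕ → Set
HasRowSums {d} A n = ∀ a → a ≤ d → NL.sum (toList (row A a)) ≡ n

lookup-row : ∀ {d} (A : Config d) k → lookup A k ≡ row A (toℕ k)
lookup-row {d} A = lookup-at (V.replicate (suc d) 0) A

row-lookup : ∀ {d} (A : Config d) a (a≤d : a ≤ d) → row A a ≡ lookup A (Fin.fromℕ< (s≤s a≤d))
row-lookup A a a≤d = trans (cong (row A) (sym (FinP.toℕ-fromℕ< (s≤s a≤d)))) (sym (lookup-row A _))

length-row : ∀ {d} (A : Config d) a → length (toList (row A a)) ≡ suc d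
length-row A a = VP.length-toList (row A a)

entry-row : ∀ {d} (A : Config d) a b → entry A a b ≡ at 0 (multiset (row A a)) b
entry-row {d} A a b = cong (λ I → at 0 I b) (at-map (toList A) a)
  where
  multiset-0 : ∀ n t → multisetFrom t (toList (V.replicate n 0)) ≡ []
  multiset-0 zero    t = refl
  multiset-0 (suc n) t = multiset-0 n (suc t)
  at-map : ∀ (vs : List (Point d)) a → at [] (L.map multiset vs) a ≡ multiset (at (V.replicate (suc d) 0) vs a)
  at-map []       a       = sym (multiset-0 (suc d) 0)
  at-map (v ∷ vs) zero    = refl
  at-map (v ∷ vs) (suc a) = at-map vs a

entry<⇒<prefix : ∀ {d} (A : Config d) a b u → b < NL.sum (toList (row A a)) → entry A a b < u → b < prefix A a u
entry<⇒<prefix A a b u b<n lt =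
  multiset-at<⇒<sum-take (toList (row A a)) 0 u b b<n (subst (_< u) (entry-row A a b) lt)

<prefix⇒entry< : ∀ {d} (A : Config d) a b u → b < prefix A a u → entry A a b < u
<prefix⇒entry< A a b u lt =
  subst (_< u) (sym (entry-row A a b)) (<sum-take⇒multiset-at< (toList (row A a)) 0 u b lt)

toList-injective : ∀ {X : Set} {n} (u v : Vec X n) → toList u ≡ toList v → u ≡ v
toList-injective u v e = trans (sym (VP.cast-is-id refl u)) (VP.toList-injective refl u v e)

prefix-injective : ∀ {d} (A B : Config d) a b → (∀ t → prefix A a t ≡ prefix B b t) → row A a ≡ row B b
prefix-injective A B a b e = toList-injective (row A a) (row B b)
  (sum-take-injective _ _ (trans (length-row A a) (sym (length-row B b))) e)

config-extensionality : ∀ {d} (A B : Config d) → (∀ a → a ≤ d → ∀ t → prefix A a t ≡ prefix B a t) → A ≡ B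
config-extensionality {d} A B e = toList-injective A B
  (at-extensionality (V.replicate (suc d) 0) (toList A) (toList B)
    (trans (VP.length-toList A) (sym (VP.length-toList B)))
    (λ a a<l → prefix-injective A B a a (e a (≤-pred (subst (a <_) (VP.length-toList A) a<l)))))

lookup-distinct : ∀ {d} (A : Config d) → (∀ {a b} → a < b → b ≤ d → row A a ≢ row A b) →
                  ∀ j l → j ≢ l → lookup A j ≢ lookup A l
lookup-distinct {d} A rows≢ j l j≢l e with <-cmp (toℕ j) (toℕ l)
... | tri≈ _ j≡l _ = j≢l (FinP.toℕ-injective j≡l)
... | tri< j<l _ _ = rows≢ j<l (≤-pred (FinP.toℕ<n l)) (trans (sym (lookup-row A j)) (trans e (lookup-row A l)))
... | tri> _ _ l<j = rows≢ l<j (≤-pred (FinP.toℕ<n j)) (trans (sym (lookup-row A l)) (trans (sym e) (lookup-row A j)))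

prefix≤rowSum : ∀ {d n} (A : Config d) → HasRowSums A n → ∀ a → a ≤ d → ∀ u → prefix A a u ≤ n
prefix≤rowSum A rs a a≤d u = subst (prefix A a u ≤_) (rs a a≤d) (sum-take-≤ _ u)

prefix-mono : ∀ {d} (A : Config d) a {t u} → t ≤ u → prefix A a t ≤ prefix A a u
prefix-mono A a = sum-take-mono (toList (row A a))

prefix-beyond : ∀ {d} (A : Config d) a t → suc d ≤ t → prefix A a t ≡ prefix A a (suc d)
prefix-beyond A a t 1+d≤t = trans (sum-take-all (toList (row A a)) t (subst (_≤ t) (sym (length-row A a)) 1+d≤t))
  (sym (sum-take-all (toList (row A a)) _ (≤-reflexive (length-row A a))))

prefix-full : ∀ {d n} (A : Config d) → HasRowSums A n → ∀ a → a ≤ d → ∀ t → suc d ≤ t → prefix A a t ≡ n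
prefix-full A rs a a≤d t 1+d≤t =
  trans (sum-take-all (toList (row A a)) t (subst (_≤ t) (sym (length-row A a)) 1+d≤t)) (rs a a≤d)

module _ {d r i : ℕ} (A : Config d) (rs : HasRowSums A (i * r)) where

  sorted⇒prefix-antitone : IsSorted d r i A → ∀ a → a < d → ∀ u → prefix A (suc a) u ≤ prefix A a u
  sorted⇒prefix-antitone (down , _) a a<d u = ≮⇒≥ λ lt →
    let b = prefix A a u
        b<n = <-≤-trans lt (prefix≤rowSum A rs (suc a) a<d u)
    in <-irrefl refl (entry<⇒<prefix A a b u (subst (b <_) (sym (rs a (<⇒≤ a<d))) b<n)
         (≤-<-trans (down a b a<d b<n) (<prefix⇒entry< A (suc a) b u lt)))

  sorted⇒prefix-wrap : IsSorted d r i A → ∀ u → prefix A 0 u ≤ suc (prefix A d u)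
  sorted⇒prefix-wrap (_ , wrap) u = ≮⇒≥ λ lt →
    let b = prefix A d u
        1+b<n = <-≤-trans lt (prefix≤rowSum A rs 0 z≤n u)
    in <-irrefl refl (entry<⇒<prefix A d b u (subst (b <_) (sym (rs d ≤-refl)) (<-trans (n<1+n b) 1+b<n))
         (≤-<-trans (wrap b 1+b<n) (<prefix⇒entry< A 0 (suc b) u lt)))

  prefix-antitone⇒sorted : (∀ a → a < d → ∀ u → prefix A (suc a) u ≤ prefix A a u) →
                           (∀ u → prefix A 0 u ≤ suc (prefix A d u)) → IsSorted d r i A
  prefix-antitone⇒sorted down wrap = sorted-down , sorted-wrap
    where
    sorted-down : ∀ a b → a < d → b < i * r → entry A a b ≤ entry A (suc a) b
    sorted-down a b a<d b<n = ≤-pred (<prefix⇒entry< A a b u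
      (≤-trans (entry<⇒<prefix A (suc a) b u (subst (b <_) (sym (rs (suc a) a<d)) b<n) ≤-refl) (down a a<d u)))
      where u = suc (entry A (suc a) b)
    sorted-wrap : ∀ b → suc b < i * r → entry A d b ≤ entry A 0 (suc b)
    sorted-wrap b 1+b<n = ≤-pred (<prefix⇒entry< A d b u
      (≤-pred (≤-trans (entry<⇒<prefix A 0 (suc b) u (subst (suc b <_) (sym (rs 0 z≤n)) 1+b<n) ≤-refl) (wrap u))))
      where u = suc (entry A 0 (suc b))

stepwise-antitone : ∀ (g : ℕ → ℕ) d → (∀ a → a < d → g (suc a) ≤ g a) →
                    ∀ {a b} → a ≤ b → b ≤ d → g b ≤ g a
stepwise-antitone g d down {a} {zero}  z≤n     _     = ≤-refl
stepwise-antitone g d down {a} {suc b} a≤1+b 1+b≤d with m≤n⇒m<n∨m≡n a≤1+b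
... | inj₂ refl       = ≤-refl
... | inj₁ (s≤s a≤b) = ≤-trans (down b 1+b≤d) (stepwise-antitone g d down a≤b (<⇒≤ 1+b≤d))

antitone-01⇒indicator : ∀ h k → (∀ a → suc a < k → h (suc a) ≤ h a) → (∀ a → a < k → h a ≤ 1) →
                        ∀ a → a < k → h a ≡ 𝟙[ a < sumUpTo h k ]
antitone-01⇒indicator h (suc k) down h≤1 a a<k with h 0 in h0
... | zero = trans (n≤0⇒n≡0 (vanish a a<k))
                   (cong 𝟙[ a <_] (sym (sumUpTo-vanishing (λ j → h (suc j)) k
                                         (λ j j<k → n≤0⇒n≡0 (vanish (suc j) (s≤s j<k))))))
  where
  vanish : ∀ a → a < suc k → h a ≤ 0
  vanish a a<k = ≤-trans (stepwise-antitone h k (λ j j<k → down j (s≤s j<k)) z≤n (≤-pred a<k)) (≤-reflexive h0)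
... | suc zero = shift a a<k
  where
  shift : ∀ a → a < suc k → h a ≡ 𝟙[ a < suc (sumUpTo (λ j → h (suc j)) k) ]
  shift zero    _         = h0
  shift (suc a) (s≤s a<k) = antitone-01⇒indicator (λ j → h (suc j)) k
    (λ j j<k → down (suc j) (s≤s j<k)) (λ j j<k → h≤1 (suc j) (s≤s j<k)) a a<k
... | suc (suc _) = ⊥-elim (<-irrefl refl (≤-trans (s≤s (s≤s z≤n)) (subst (_≤ 1) h0 (h≤1 0 z<s))))

column-staircase : ∀ (g : ℕ → ℕ) d → (∀ a → a < d → g (suc a) ≤ g a) → g 0 ≤ suc (g d) →
                   ∀ a → a ≤ d → g a ≡ g d + 𝟙[ a < sumUpTo (λ j → g j ∸ g d) (suc d) ]
column-staircase g d down wrap a a≤d =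
  trans (sym (m+[n∸m]≡n (stepwise-antitone g d down a≤d ≤-refl)))
        (cong (g d +_) (antitone-01⇒indicator h (suc d) h-down h≤1 a (s≤s a≤d)))
  where
  h : ℕ → ℕ
  h j = g j ∸ g d
  h-down : ∀ a → suc a < suc d → h (suc a) ≤ h a
  h-down a (s≤s a<d) = ∸-monoˡ-≤ (g d) (down a a<d)
  h≤1 : ∀ a → a < suc d → h a ≤ 1
  h≤1 a (s≤s a≤d) = m≤n+o⇒m∸n≤o (g a) (g d)
    (subst (g a ≤_) (+-comm 1 (g d)) (≤-trans (stepwise-antitone g d down z≤n a≤d) wrap))

sumUpTo-suc : ∀ h k → sumUpTo h (suc k) ≡ sumUpTo h k + h k
sumUpTo-suc h zero    = +-comm (h 0) 0
sumUpTo-suc h (suc k) = trans (cong (h 0 +_) (sumUpTo-suc (λ j → h (suc j)) k)) (sym (+-assoc (h 0) _ _))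

des-applyUpTo : ∀ f k → des (L.applyUpTo f (suc k)) ≡ sumUpTo (λ j → 𝟙[ f (suc j) < f j ]) k
des-applyUpTo f zero    = refl
des-applyUpTo f (suc k) = cong (𝟙[ f 1 < f 0 ] +_) (des-applyUpTo (λ j → f (suc j)) k)

des<length : ∀ x xs → des (x ∷ xs) < length (x ∷ xs)
des<length x []       = z<s
des<length x (y ∷ xs) =
  subst (_≤ length (x ∷ y ∷ xs)) (+-suc 𝟙[ y < x ] _) (+-mono-≤ (𝟙[<]≤1 y x) (des<length y xs))

sumUpTo-descents : ∀ (S : ℕ → ℕ) d → 1 ≤ d → S 0 ≡ 0 → S (suc d) ≡ 0 → 1 ≤ S d →
  sumUpTo (λ k → 𝟙[ S (suc k) < S k ]) (suc d) ≡ des (L.applyUpTo (λ t → S (suc t)) d) + 1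
sumUpTo-descents S (suc L) _ S0 S[2+L] 1≤S[1+L] = begin
  𝟙[ S 1 < S 0 ] + sumUpTo descent (suc L)             ≡⟨ cong₂ _+_ (cong 𝟙[ S 1 <_] S0) (sumUpTo-suc descent L) ⟩
  sumUpTo descent L + descent L                         ≡⟨ cong₂ _+_ (sym (des-applyUpTo (λ t → S (suc t)) L)) last ⟩
  des (L.applyUpTo (λ t → S (suc t)) (suc L)) + 1       ∎
  where
  open ≡-Reasoning
  descent : ℕ → ℕ
  descent k = 𝟙[ S (suc (suc k)) < S (suc k) ]
  last : descent L ≡ 1
  last = trans (cong 𝟙[_< S (suc L) ] S[2+L]) (𝟙[<]-of-< 1≤S[1+L])

des-applyUpTo-< : ∀ f d → 1 ≤ d → des (L.applyUpTo f d) < d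
des-applyUpTo-< f (suc L) _ = subst (des (L.applyUpTo f (suc L)) <_) (cong suc (LP.length-applyUpTo (λ t → f (suc t)) L))
  (des<length (f 0) (L.applyUpTo (λ t → f (suc t)) L))

module _ {X : Set} (f : ℕ → List X) where

  ∈-concatMap-upTo⁻ : ∀ {n x} → x ∈ concatMap f (upTo n) → Σ ℕ λ b → b < n × x ∈ f b
  ∈-concatMap-upTo⁻ x∈ with find (∈-concatMap⁻ f x∈)
  ... | b , b∈ , x∈fb = b , ∈-upTo⁻ b∈ , x∈fb

  ∈-concatMap-upTo⁺ : ∀ {n x b} → b < n → x ∈ f b → x ∈ concatMap f (upTo n)
  ∈-concatMap-upTo⁺ b<n x∈fb = ∈-concatMap⁺ f (lose (∈-upTo⁺ b<n) x∈fb)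

  AllPairs-concatMap-upTo : ∀ {R : X → X → Set} n → (∀ b → b < n → AllPairs R (f b)) →
    (∀ {b c x y} → b < c → c < n → x ∈ f b → y ∈ f c → R x y) → AllPairs R (concatMap f (upTo n))
  AllPairs-concatMap-upTo n within across =
    APP.concat⁺ (LAllP.map⁺ (LAllP.applyUpTo⁺₁ (λ b → b) n (within _)))
                (APP.map⁺ (APP.applyUpTo⁺₁ (λ b → b) n λ b<c c<n →
                   LAll.tabulate λ x∈ → LAll.tabulate λ y∈ → across b<c c<n x∈ y∈))

AllPairs-asym-≡ : ∀ {X : Set} (R : X → X → Set) → (∀ {x y} → R x y → ¬ R y x) →
  ∀ {xs ys} → AllPairs R xs → AllPairs R ys →
  (∀ {x} → x ∈ xs → x ∈ ys) → (∀ {x} → x ∈ ys → x ∈ xs) → xs ≡ ys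
AllPairs-asym-≡ R asym {[]}     {[]}     _ _ _ _ = refl
AllPairs-asym-≡ R asym {[]}     {y ∷ ys} _ _ _ ⊇ with () ← ⊇ (here refl)
AllPairs-asym-≡ R asym {x ∷ xs} {[]}     _ _ ⊆ _ with () ← ⊆ (here refl)
AllPairs-asym-≡ R asym {x ∷ xs} {y ∷ ys} (x< ∷ sxs) (y< ∷ sys) ⊆ ⊇ =
  cong₂ _∷_ x≡y (AllPairs-asym-≡ R asym sxs sys ⊆′ ⊇′)
  where
  irrefl : ∀ {z} → ¬ R z z
  irrefl r = asym r r
  x≡y : x ≡ y
  x≡y with ⊆ (here refl) | ⊇ (here refl)
  ... | here e     | _          = e
  ... | there _    | here e     = sym e
  ... | there x∈ys | there y∈xs = ⊥-elim (asym (LAll.lookup x< y∈xs) (LAll.lookup y< x∈ys))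
  ⊆′ : ∀ {z} → z ∈ xs → z ∈ ys
  ⊆′ z∈xs with ⊆ (there z∈xs)
  ... | there z∈ys = z∈ys
  ... | here refl  = ⊥-elim (irrefl (subst (λ w → R w _) x≡y (LAll.lookup x< z∈xs)))
  ⊇′ : ∀ {z} → z ∈ ys → z ∈ xs
  ⊇′ z∈ys with ⊇ (there z∈ys)
  ... | there z∈xs = z∈xs
  ... | here refl  = ⊥-elim (irrefl (subst (λ w → R w _) (sym x≡y) (LAll.lookup y< z∈ys)))

injective⇒surjective : ∀ {n} (f : Fin n → Fin n) → (∀ {x y} → f x ≡ f y → x ≡ y) →
                       ∀ y → Σ (Fin n) λ x → f x ≡ y
injective⇒surjective {suc n} f f-inj y with FinP.any? (λ x → f x FinP.≟ y)
... | yes hit = hit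
... | no miss = ⊥-elim (1+n≰n (FinP.injective⇒≤ {f = punched} punched-injective))
  where
  f≢y : ∀ x → y ≢ f x
  f≢y x e = miss (x , sym e)
  punched : Fin (suc n) → Fin n
  punched x = Fin.punchOut (f≢y x)
  punched-injective : ∀ {x x′} → punched x ≡ punched x′ → x ≡ x′
  punched-injective e = f-inj (FinP.punchOut-injective (f≢y _) (f≢y _) e)

infix 4 _∈[1,_]
_∈[1,_] : ℕ → ℕ → Set
t ∈[1, d ] = 1 ≤ t × t ≤ d

module OntoInterval (d : ℕ) (S : ℕ → ℕ)
  (onto : ∀ y → y ∈[1, d ] → Σ ℕ λ t → t ∈[1, d ] × S t ≡ y) where

  private
    chosen : Fin d → ℕ
    chosen y = proj₁ (onto (suc (toℕ y)) (s≤s z≤n , FinP.toℕ<n y))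

    chosen-∈ : ∀ y → chosen y ∈[1, d ]
    chosen-∈ y = proj₁ (proj₂ (onto (suc (toℕ y)) (s≤s z≤n , FinP.toℕ<n y)))

    S∘chosen : ∀ y → S (chosen y) ≡ suc (toℕ y)
    S∘chosen y = proj₂ (proj₂ (onto (suc (toℕ y)) (s≤s z≤n , FinP.toℕ<n y)))

    toFin : ∀ {t} → t ∈[1, d ] → Fin d
    toFin {suc t} (_ , t<d) = Fin.fromℕ< t<d

    toFin-injective : ∀ {t u} (p : t ∈[1, d ]) (q : u ∈[1, d ]) → toFin p ≡ toFin q → t ≡ u
    toFin-injective {suc t} {suc u} (_ , t<d) (_ , u<d) e =
      cong suc (trans (sym (FinP.toℕ-fromℕ< t<d)) (trans (cong toℕ e) (FinP.toℕ-fromℕ< u<d)))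

    chosen-injective : ∀ {y z} → toFin (chosen-∈ y) ≡ toFin (chosen-∈ z) → y ≡ z
    chosen-injective {y} {z} e = FinP.toℕ-injective (suc-injective
      (trans (sym (S∘chosen y)) (trans (cong S (toFin-injective _ _ e)) (S∘chosen z))))

    -- The chosen preimages form an injective self-map of Fin d, hence every t ∈ [1, d] is one of them.
    chosen-onto : ∀ t → (p : t ∈[1, d ]) → Σ (Fin d) λ y → chosen y ≡ t
    chosen-onto t p with injective⇒surjective (λ y → toFin (chosen-∈ y)) chosen-injective (toFin p)
    ... | y , e = y , toFin-injective _ p e

  onto⇒positive : ∀ t → t ∈[1, d ] → 1 ≤ S t
  onto⇒positive t p with chosen-onto t p
  ... | y , refl = subst (1 ≤_) (sym (S∘chosen y)) (s≤s z≤n)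

  onto⇒injective : ∀ {t u} → t ∈[1, d ] → u ∈[1, d ] → S t ≡ S u → t ≡ u
  onto⇒injective {t} {u} p q e with chosen-onto t p | chosen-onto u q
  ... | y , refl | z , refl =
    cong chosen (FinP.toℕ-injective (suc-injective (trans (sym (S∘chosen y)) (trans e (S∘chosen z)))))

module Increasing {c ℓ₁ ℓ₂} (P : StrictPartialOrder c ℓ₁ ℓ₂) (f : ℕ → StrictPartialOrder.Carrier P) (N : ℕ)
  (step : ∀ t → t < N → StrictPartialOrder._<_ P (f t) (f (suc t))) where

  open StrictPartialOrder P using (irrefl; module Eq) renaming (_<_ to _≺_; trans to ≺-trans)

  increasing : ∀ {t u} → t < u → u ≤ N → f t ≺ f u
  increasing {t} {suc u} t<1+u 1+u≤N with m≤n⇒m<n∨m≡n (≤-pred t<1+u)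
  ... | inj₂ refl = step t 1+u≤N
  ... | inj₁ t<u  = ≺-trans (increasing t<u (<⇒≤ 1+u≤N)) (step u 1+u≤N)

  increasing-reflects : ∀ {t u} → t ≤ N → u ≤ N → f t ≺ f u → t < u
  increasing-reflects {t} {u} t≤N u≤N ft<fu with <-cmp t u
  ... | tri< t<u _ _  = t<u
  ... | tri≈ _ refl _ = ⊥-elim (irrefl Eq.refl ft<fu)
  ... | tri> _ _ u<t  = ⊥-elim (irrefl Eq.refl (≺-trans ft<fu (increasing u<t t≤N)))

lexℕ×ℕ : StrictPartialOrder 0ℓ 0ℓ 0ℓ
lexℕ×ℕ = ×-strictPartialOrder <-strictPartialOrder <-strictPartialOrder

foldr₁-⊓-≤ : ∀ {m} (v : Vec ℕ (suc m)) j → foldr₁ _⊓_ v ≤ lookup v j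
foldr₁-⊓-≤ (x V.∷ V.[])     Fin.zero    = ≤-refl
foldr₁-⊓-≤ (x V.∷ y V.∷ ys) Fin.zero    = m⊓n≤m x _
foldr₁-⊓-≤ (x V.∷ y V.∷ ys) (Fin.suc j) = ≤-trans (m⊓n≤n x _) (foldr₁-⊓-≤ (y V.∷ ys) j)

foldr₁-⊓-glb : ∀ {m} (v : Vec ℕ (suc m)) c → (∀ j → c ≤ lookup v j) → c ≤ foldr₁ _⊓_ v
foldr₁-⊓-glb (x V.∷ V.[])     c c≤ = c≤ Fin.zero
foldr₁-⊓-glb (x V.∷ y V.∷ ys) c c≤ = ⊓-glb (c≤ Fin.zero) (foldr₁-⊓-glb (y V.∷ ys) c (λ j → c≤ (Fin.suc j)))

∈-if⁻ : ∀ {c : Bool} {x y : ℕ} → x ∈ (if c then y ∷ [] else []) → T c × x ≡ y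
∈-if⁻ {true} (here refl) = _ , refl

∈-if⁺ : ∀ {c : Bool} {y : ℕ} → T c → y ∈ (if c then y ∷ [] else [])
∈-if⁺ {true} _ = here refl

AllPairs-if : ∀ {R : ℕ → ℕ → Set} (c : Bool) (y : ℕ) → AllPairs R (if c then y ∷ [] else [])
AllPairs-if true  _ = [] ∷ []
AllPairs-if false _ = []

∸≤∸+1 : ∀ {p q p′ q′} → q′ ≤ p′ → p + q′ ≤ p′ + q + 1 → p ∸ q ≤ p′ ∸ q′ + 1
∸≤∸+1 {p} {q} {p′} {q′} q′≤p′ le = m≤n+o⇒m∸n≤o p q (+-cancelʳ-≤ q′ p _ (begin
  p + q′                      ≤⟨ le ⟩
  p′ + q + 1                  ≡⟨ cong (λ x → x + q + 1) (m∸n+n≡m q′≤p′) ⟨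
  p′ ∸ q′ + q′ + q + 1        ≡⟨ rearrange (p′ ∸ q′) q′ q ⟩
  q + (p′ ∸ q′ + 1) + q′      ∎))
  where
  open ≤-Reasoning
  rearrange : ∀ x y z → x + y + z + 1 ≡ z + (x + 1) + y
  rearrange = solve-∀

squeeze : ∀ {q b x y} → b < q + x → q + y ≤ b → x ≤ 1 → q ≡ b × x ≡ 1 × y ≡ 0
squeeze {q} {b} {zero}  {y} b<q+0 q+y≤b _ =
  ⊥-elim (<-irrefl refl (<-≤-trans b<q+0 (≤-trans (≤-reflexive (+-identityʳ q)) (≤-trans (m≤m+n q y) q+y≤b))))
squeeze {q} {b} {suc zero} {y} b<q+1 q+y≤b _ = q≡b , refl , y≡0
  where
  q≡b : q ≡ b
  q≡b = ≤-antisym (≤-trans (m≤m+n q y) q+y≤b) (≤-pred (subst (b <_) (+-comm q 1) b<q+1))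
  y≡0 : y ≡ 0
  y≡0 = n≤0⇒n≡0 (+-cancelˡ-≤ q y 0 (subst (q + y ≤_) (trans (sym q≡b) (sym (+-identityʳ q))) q+y≤b))
squeeze {x = suc (suc _)} _ _ (s≤s ())

-- Staircases

module Staircase {d n : ℕ} (d≥1 : 1 ≤ d) (A : Config d) (rs : HasRowSums A n) (Q S : ℕ → ℕ)
  (shape : ∀ a → a ≤ d → ∀ t → prefix A a t ≡ Q t + 𝟙[ a < S t ])
  (S0 : S 0 ≡ 0) (S[1+d] : S (suc d) ≡ 0) (S≤d : ∀ t → S t ≤ d)
  (S-onto : ∀ y → y ∈[1, d ] → Σ ℕ λ t → t ∈[1, d ] × S t ≡ y) where

  open OntoInterval d S S-onto

  shape-above : ∀ {a t} → a ≤ d → a < S t → prefix A a t ≡ suc (Q t)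
  shape-above {a} {t} a≤d a<S = trans (shape a a≤d t) (trans (cong (Q t +_) (𝟙[<]-of-< a<S)) (+-comm (Q t) 1))

  shape-below : ∀ {a t} → a ≤ d → S t ≤ a → prefix A a t ≡ Q t
  shape-below {a} {t} a≤d S≤a = trans (shape a a≤d t) (trans (cong (Q t +_) (𝟙[<]-of-≥ S≤a)) (+-identityʳ _))

  prefix-last : ∀ t → prefix A d t ≡ Q t
  prefix-last t = shape-below ≤-refl (S≤d t)

  Q0 : Q 0 ≡ 0
  Q0 = sym (prefix-last 0)

  Q[1+d] : Q (suc d) ≡ n
  Q[1+d] = trans (sym (prefix-last (suc d))) (prefix-full A rs d ≤-refl (suc d) ≤-refl)

  Q-step : ∀ t → Q t ≤ Q (suc t)
  Q-step t = subst₂ _≤_ (prefix-last t) (prefix-last (suc t)) (prefix-mono A d (n≤1+n t))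

  Q-jump : ∀ t → S (suc t) < S t → Q t < Q (suc t)
  Q-jump t lt =
    subst₂ _≤_ (shape-above (S≤d _) lt) (shape-below (S≤d _) ≤-refl) (prefix-mono A (S (suc t)) (n≤1+n t))

  S-step-≢ : ∀ k → k ≤ d → S k ≢ S (suc k)
  S-step-≢ zero    _   e = <⇒≢ (onto⇒positive 1 (≤-refl , d≥1)) (trans (sym S0) e)
  S-step-≢ (suc k) k<d e with suc k <? d
  ... | yes 1+k<d = 1+n≢n (sym (onto⇒injective (s≤s z≤n , k<d) (s≤s z≤n , 1+k<d) e))
  ... | no  1+k≮d with ≤-antisym k<d (≮⇒≥ 1+k≮d)
  ...   | refl = <⇒≢ (onto⇒positive (suc k) (s≤s z≤n , k<d)) (sym (trans e S[1+d]))

  open StrictPartialOrder lexℕ×ℕ using () renaming (_<_ to _<ₗₑₓ_)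

  position : ℕ → ℕ × ℕ
  position t = Q t , S t

  position-step : ∀ t → t < suc d → position t <ₗₑₓ position (suc t)
  position-step t (s≤s t≤d) with <-cmp (S t) (S (suc t))
  ... | tri≈ _ e _  = ⊥-elim (S-step-≢ t t≤d e)
  ... | tri> _ _ gt = inj₁ (Q-jump t gt)
  ... | tri< lt _ _ with m≤n⇒m<n∨m≡n (Q-step t)
  ...   | inj₁ Q<  = inj₁ Q<
  ...   | inj₂ Q≡  = inj₂ (Q≡ , lt)

  open Increasing lexℕ×ℕ position (suc d) position-step

  Q<n : ∀ t → t ≤ d → Q t < n
  Q<n t t≤d with increasing (s≤s t≤d) ≤-refl
  ... | inj₁ Q<   = subst (Q t <_) Q[1+d] Q<
  ... | inj₂ (_ , S<) = ⊥-elim (n≮0 (subst (S t <_) S[1+d] S<))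

  <n⇒<row-sum : ∀ a → a ≤ d → ∀ {b} → b < n → b < NL.sum (toList (row A a))
  <n⇒<row-sum a a≤d b<n = subst (_ <_) (sym (rs a a≤d)) b<n

  Mark : ℕ → ℕ → Set
  Mark a b = Σ ℕ λ t → t ∈[1, d ] × S t ≡ suc a × Q t ≡ b

  mark-of-step : ∀ a b → a < d → b < n → entry A a b < entry A (suc a) b → Mark a b
  mark-of-step a b a<d b<n lt = u , (s≤s z≤n , u≤d) , S≡ , proj₁ squeezed
    where
    -- At u = I_{ab} + 1 the prefix sum of row a has passed b while that of row a+1 has not.
    u : ℕ
    u = suc (entry A a b)
    u≤d : u ≤ d
    u≤d = ≤-trans lt (≤-pred (<prefix⇒entry< A (suc a) b (suc d)
            (subst (b <_) (sym (prefix-full A rs (suc a) a<d (suc d) ≤-refl)) b<n)))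
    above : b < Q u + 𝟙[ a < S u ]
    above = subst (b <_) (shape a (<⇒≤ a<d) u) (entry<⇒<prefix A a b u (<n⇒<row-sum a (<⇒≤ a<d) b<n) ≤-refl)
    below : Q u + 𝟙[ suc a < S u ] ≤ b
    below = subst (_≤ b) (shape (suc a) a<d u) (≮⇒≥ λ b<p → <⇒≱ lt (≤-pred (<prefix⇒entry< A (suc a) b u b<p)))
    squeezed : Q u ≡ b × 𝟙[ a < S u ] ≡ 1 × 𝟙[ suc a < S u ] ≡ 0
    squeezed = squeeze above below (𝟙[<]≤1 a (S u))
    S≡ : S u ≡ suc a
    S≡ = ≤-antisym (𝟙[<]≡0⇒≥ (proj₂ (proj₂ squeezed))) (𝟙[<]≡1⇒< (proj₁ (proj₂ squeezed)))

  step-of-mark : ∀ a b → a < d → b < n → Mark a b → entry A a b < entry A (suc a) b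
  step-of-mark a _ a<d b<n (t , _ , S≡ , refl) = <-≤-trans upper lower
    where
    upper : entry A a (Q t) < t
    upper = <prefix⇒entry< A a (Q t) t
      (subst (Q t <_) (sym (shape-above (<⇒≤ a<d) (subst (a <_) (sym S≡) (n<1+n a)))) (n<1+n (Q t)))
    lower : t ≤ entry A (suc a) (Q t)
    lower = ≮⇒≥ λ e<t → <-irrefl refl
      (subst (Q t <_) (shape-below a<d (≤-reflexive S≡)) (entry<⇒<prefix A (suc a) (Q t) t (<n⇒<row-sum (suc a) a<d b<n) e<t))

  Before : ℕ → ℕ → Set
  Before x y = Σ ℕ λ t → Σ ℕ λ u → t ∈[1, d ] × u ∈[1, d ] × t < u × S t ≡ x × S u ≡ y

  Before-asym : ∀ {x y} → Before x y → ¬ Before y x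
  Before-asym (t , u , p , q , t<u , refl , refl) (u′ , t′ , q′ , p′ , u′<t′ , e₁ , e₂)
    with onto⇒injective q′ q e₁ | onto⇒injective p′ p e₂
  ... | refl | refl = <-asym t<u u′<t′

  Before-of-Marks : ∀ {a b a′ b′} → Mark a b → Mark a′ b′ → (b , suc a) <ₗₑₓ (b′ , suc a′) →
                    Before (suc a) (suc a′)
  Before-of-Marks (t , p , S≡ , Q≡) (u , q , S≡′ , Q≡′) lt = t , u , p , q , t<u , S≡ , S≡′
    where
    t<u : t < u
    t<u = increasing-reflects (m≤n⇒m≤1+n (proj₂ p)) (m≤n⇒m≤1+n (proj₂ q))
            (subst₂ _<ₗₑₓ_ (sym (cong₂ _,_ Q≡ S≡)) (sym (cong₂ _,_ Q≡′ S≡′)) lt)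

  markAt : ℕ → ℕ → List ℕ
  markAt b a = if entry A a b <ᵇ entry A (suc a) b then suc a ∷ [] else []

  ∈-marksInColumn⁻ : ∀ {x} b → b < n → x ∈ marksInColumn A b → Σ ℕ λ a → x ≡ suc a × Mark a b
  ∈-marksInColumn⁻ b b<n x∈ with ∈-concatMap-upTo⁻ (markAt b) {d} x∈
  ... | a , a<d , x∈′ with ∈-if⁻ x∈′
  ...   | step , refl = a , refl , mark-of-step a b a<d b<n (<ᵇ⇒< _ _ step)

  marks : List ℕ
  marks = concatMap (marksInColumn A) (upTo n)

  marks-AllPairs : AllPairs Before marks
  marks-AllPairs = AllPairs-concatMap-upTo (marksInColumn A) n within across
    where
    within : ∀ b → b < n → AllPairs Before (marksInColumn A b)
    within b b<n = AllPairs-concatMap-upTo (markAt b) d (λ a _ → AllPairs-if _ (suc a))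
      λ {a} {a′} a<a′ a′<d x∈ y∈ → case ∈-if⁻ x∈ , ∈-if⁻ y∈ of λ where
        ((step , refl) , (step′ , refl)) → Before-of-Marks
          (mark-of-step a b (<-trans a<a′ a′<d) b<n (<ᵇ⇒< _ _ step))
          (mark-of-step a′ b a′<d b<n (<ᵇ⇒< _ _ step′)) (inj₂ (refl , s≤s a<a′))
    across : ∀ {b c x y} → b < c → c < n → x ∈ marksInColumn A b → y ∈ marksInColumn A c → Before x y
    across {b} {c} b<c c<n x∈ y∈ with ∈-marksInColumn⁻ b (<-trans b<c c<n) x∈ | ∈-marksInColumn⁻ c c<n y∈
    ... | a , refl , mark | a′ , refl , mark′ = Before-of-Marks mark mark′ (inj₁ b<c)

  ∈-marks⁻ : ∀ {x} → x ∈ marks → Σ ℕ λ t → t ∈[1, d ] × S t ≡ x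
  ∈-marks⁻ x∈ with ∈-concatMap-upTo⁻ (marksInColumn A) x∈
  ... | b , b<n , x∈′ with ∈-marksInColumn⁻ b b<n x∈′
  ...   | a , refl , (t , p , S≡ , _) = t , p , S≡

  ∈-marks⁺ : ∀ t → t ∈[1, d ] → S t ∈ marks
  ∈-marks⁺ t p with S t in S≡ | onto⇒positive t p
  ... | suc a | _ = ∈-concatMap-upTo⁺ (marksInColumn A) (Q<n t (proj₂ p))
    (∈-concatMap-upTo⁺ (markAt (Q t)) a<d
      (∈-if⁺ (<⇒<ᵇ (step-of-mark a (Q t) a<d (Q<n t (proj₂ p)) (t , p , S≡ , refl)))))
    where
    a<d : a < d
    a<d = subst (_≤ d) S≡ (S≤d t)

  word : List ℕ
  word = L.applyUpTo (λ t → S (suc t)) d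

  word-AllPairs : AllPairs Before word
  word-AllPairs = APP.applyUpTo⁺₁ _ d λ {t} {u} t<u u<d →
    suc t , suc u , (s≤s z≤n , <-trans t<u u<d) , (s≤s z≤n , u<d) , s≤s t<u , refl , refl

  ∈-word⁻ : ∀ {x} → x ∈ word → Σ ℕ λ t → t ∈[1, d ] × S t ≡ x
  ∈-word⁻ x∈ with ∈-applyUpTo⁻ (λ t → S (suc t)) x∈
  ... | t , t<d , refl = suc t , (s≤s z≤n , t<d) , refl

  ∈-word⁺ : ∀ t → t ∈[1, d ] → S t ∈ word
  ∈-word⁺ (suc t) (_ , t<d) = ∈-applyUpTo⁺ (λ t → S (suc t)) t<d

  marks≡word : marks ≡ word
  marks≡word = AllPairs-asym-≡ Before Before-asym marks-AllPairs word-AllPairs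
    (λ x∈ → case ∈-marks⁻ x∈ of λ where (t , p , refl) → ∈-word⁺ t p)
    (λ x∈ → case ∈-word⁻ x∈ of λ where (t , p , refl) → ∈-marks⁺ t p)

  word-unique : Unique word
  word-unique = AP.map (λ before → λ { refl → Before-asym before before }) word-AllPairs

  word↭ : word ↭ L.map suc (upTo d)
  word↭ = ∼bag⇒↭ (unique∧set⇒bag word-unique (UniqP.map⁺ suc-injective (UniqP.upTo⁺ d)) (mk⇔ to from))
    where
    to : ∀ {x} → x ∈ word → x ∈ L.map suc (upTo d)
    to x∈ with ∈-word⁻ x∈
    ... | t , p , refl with S t in S≡ | onto⇒positive t p
    ...   | suc a | _ = ∈-map⁺ suc (∈-upTo⁺ (subst (_≤ d) S≡ (S≤d t)))
    from : ∀ {x} → x ∈ L.map suc (upTo d) → x ∈ word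
    from x∈ with ∈-map⁻ suc x∈
    ... | a , a∈ , refl with S-onto (suc a) (s≤s z≤n , ∈-upTo⁻ a∈)
    ...   | t , p , S≡ = subst (_∈ word) S≡ (∈-word⁺ t p)

  descent : ℕ → ℕ
  descent k = 𝟙[ S (suc k) < S k ]

  gap : ℕ → ℕ
  gap k = Q (suc k) ∸ Q k ∸ descent k

  descent≤ΔQ : ∀ k → descent k ≤ Q (suc k) ∸ Q k
  descent≤ΔQ k with S (suc k) <? S k
  ... | yes lt rewrite 𝟙[<]-of-< lt = m<n⇒0<n∸m (Q-jump k lt)
  ... | no ¬lt rewrite 𝟙[<]-of-≥ (≮⇒≥ ¬lt) = z≤n

  Q-recurrence : ∀ k → Q (suc k) ≡ Q k + gap k + descent k
  Q-recurrence k = begin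
    Q (suc k)                           ≡⟨ m+[n∸m]≡n (Q-step k) ⟨
    Q k + (Q (suc k) ∸ Q k)             ≡⟨ cong (Q k +_) (m∸n+n≡m (descent≤ΔQ k)) ⟨
    Q k + (gap k + descent k)           ≡⟨ +-assoc (Q k) _ _ ⟨
    Q k + gap k + descent k             ∎
    where open ≡-Reasoning

  coord : ℕ → ℕ → ℕ
  coord a k = at 0 (toList (row A a)) k

  coord-shape : ∀ a → a ≤ d → ∀ k → coord a k + 𝟙[ a < S k ] ≡ gap k + descent k + 𝟙[ a < S (suc k) ]
  coord-shape a a≤d k = +-cancelˡ-≡ (Q k) _ _ (begin
    Q k + (coord a k + 𝟙[ a < S k ])                ≡⟨ cong (Q k +_) (+-comm (coord a k) _) ⟩
    Q k + (𝟙[ a < S k ] + coord a k)                ≡⟨ +-assoc (Q k) _ _ ⟨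
    Q k + 𝟙[ a < S k ] + coord a k                  ≡⟨ cong (_+ coord a k) (shape a a≤d k) ⟨
    prefix A a k + coord a k                        ≡⟨ sum-take-suc (toList (row A a)) k ⟨
    prefix A a (suc k)                              ≡⟨ shape a a≤d (suc k) ⟩
    Q (suc k) + 𝟙[ a < S (suc k) ]                  ≡⟨ cong (_+ 𝟙[ a < S (suc k) ]) (Q-recurrence k) ⟩
    Q k + gap k + descent k + 𝟙[ a < S (suc k) ]    ≡⟨ cong (_+ 𝟙[ a < S (suc k) ]) (+-assoc (Q k) _ _) ⟩
    Q k + (gap k + descent k) + 𝟙[ a < S (suc k) ]  ≡⟨ +-assoc (Q k) _ _ ⟩
    Q k + (gap k + descent k + 𝟙[ a < S (suc k) ])  ∎)
    where open ≡-Reasoning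

  gap≤coord : ∀ a → a ≤ d → ∀ k → gap k ≤ coord a k
  gap≤coord a a≤d k = +-cancelʳ-≤ 𝟙[ a < S k ] (gap k) (coord a k) (begin
    gap k + 𝟙[ a < S k ]                            ≤⟨ +-monoʳ-≤ (gap k) (𝟙[<]-subadditive a (S (suc k)) (S k)) ⟩
    gap k + (descent k + 𝟙[ a < S (suc k) ])        ≡⟨ +-assoc (gap k) _ _ ⟨
    gap k + descent k + 𝟙[ a < S (suc k) ]          ≡⟨ coord-shape a a≤d k ⟨
    coord a k + 𝟙[ a < S k ]                        ∎)
    where open ≤-Reasoning

  coord-next : ∀ k → coord (S (suc k)) k ≡ gap k
  coord-next k = +-cancelʳ-≡ (descent k) _ _ (begin
    coord (S (suc k)) k + descent k                  ≡⟨ coord-shape (S (suc k)) (S≤d _) k ⟩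
    gap k + descent k + 𝟙[ S (suc k) < S (suc k) ]   ≡⟨ cong (gap k + descent k +_) (𝟙[<]-irrefl (S (suc k))) ⟩
    gap k + descent k + 0                            ≡⟨ +-identityʳ _ ⟩
    gap k + descent k                                ∎)
    where open ≡-Reasoning

  coord-last : ∀ k → coord d k ≡ gap k + descent k
  coord-last k = begin
    coord d k                                        ≡⟨ +-identityʳ _ ⟨
    coord d k + 0                                    ≡⟨ cong (coord d k +_) (𝟙[<]-of-≥ (S≤d k)) ⟨
    coord d k + 𝟙[ d < S k ]                         ≡⟨ coord-shape d ≤-refl k ⟩
    gap k + descent k + 𝟙[ d < S (suc k) ]           ≡⟨ cong (gap k + descent k +_) (𝟙[<]-of-≥ (S≤d (suc k))) ⟩
    gap k + descent k + 0                            ≡⟨ +-identityʳ _ ⟩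
    gap k + descent k                                ∎
    where open ≡-Reasoning

  coord-attains-1+gap : ∀ k → k ≤ d → Σ ℕ λ a → a ≤ d × coord a k ≡ suc (gap k)
  coord-attains-1+gap k k≤d with <-cmp (S (suc k)) (S k)
  ... | tri≈ _ e _  = ⊥-elim (S-step-≢ k k≤d (sym e))
  ... | tri< lt _ _ = d , ≤-refl , trans (coord-last k) (trans (cong (gap k +_) (𝟙[<]-of-< lt)) (+-comm (gap k) 1))
  ... | tri> _ _ gt = S k , S≤d k , +-cancelʳ-≡ 0 _ _ (begin
    coord (S k) k + 0                                ≡⟨ cong (coord (S k) k +_) (𝟙[<]-irrefl (S k)) ⟨
    coord (S k) k + 𝟙[ S k < S k ]                   ≡⟨ coord-shape (S k) (S≤d k) k ⟩
    gap k + descent k + 𝟙[ S k < S (suc k) ]         ≡⟨ cong₂ (λ x y → gap k + x + y) (𝟙[<]-of-≥ (<⇒≤ gt)) (𝟙[<]-of-< gt) ⟩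
    gap k + 0 + 1                                    ≡⟨ cong (_+ 1) (+-identityʳ (gap k)) ⟩
    gap k + 1                                        ≡⟨ +-comm (gap k) 1 ⟩
    suc (gap k)                                      ≡⟨ +-identityʳ _ ⟨
    suc (gap k) + 0                                  ∎)
    where open ≡-Reasoning

  coord-lookup : ∀ j k → lookup (lookup A j) k ≡ coord (toℕ j) (toℕ k)
  coord-lookup j k = trans (lookup-at 0 (lookup A j) k) (cong (λ v → at 0 (toList v) (toℕ k)) (lookup-row A j))

  comp′≡gaps : comp′ A ≡ tabulate (λ k → gap (toℕ k))
  comp′≡gaps = VP.tabulate-cong λ k → ≤-antisym (upper k) (lower k)
    where
    column : Fin (suc d) → Vec ℕ (suc d)
    column k = V.map (λ v → lookup v k) A
    column-entry : ∀ k j → lookup (column k) j ≡ coord (toℕ j) (toℕ k)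
    column-entry k j = trans (VP.lookup-map j _ A) (coord-lookup j k)
    upper : ∀ k → foldr₁ _⊓_ (column k) ≤ gap (toℕ k)
    upper k = ≤-trans (foldr₁-⊓-≤ (column k) j) (≤-reflexive (begin
      lookup (column k) j                     ≡⟨ column-entry k j ⟩
      coord (toℕ j) (toℕ k)                   ≡⟨ cong (λ a → coord a (toℕ k)) (FinP.toℕ-fromℕ< (s≤s (S≤d _))) ⟩
      coord (S (suc (toℕ k))) (toℕ k)         ≡⟨ coord-next (toℕ k) ⟩
      gap (toℕ k)                             ∎))
      where
      open ≡-Reasoning
      j : Fin (suc d)
      j = Fin.fromℕ< (s≤s (S≤d (suc (toℕ k))))
    lower : ∀ k → gap (toℕ k) ≤ foldr₁ _⊓_ (column k)
    lower k = foldr₁-⊓-glb (column k) _ λ j →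
      subst (gap (toℕ k) ≤_) (sym (column-entry k j)) (gap≤coord (toℕ j) (≤-pred (FinP.toℕ<n j)) (toℕ k))

  comp′-bounded : ∀ m → (∀ a → a ≤ d → ∀ k → k ≤ d → coord a k ≤ m) → All (_≤ m ∸ 1) (comp′ A)
  comp′-bounded m coord≤m = subst (All (_≤ m ∸ 1)) (sym comp′≡gaps) (VAllP.tabulate⁺ λ k →
    let k≤d = ≤-pred (FinP.toℕ<n k) in
    case coord-attains-1+gap (toℕ k) k≤d of λ where
      (a , a≤d , e) → ∸-monoˡ-≤ 1 (subst (_≤ m) e (coord≤m a a≤d (toℕ k) k≤d)))

  sum-comp′+des : V.sum (comp′ A) + (des word + 1) ≡ n
  sum-comp′+des = begin
    V.sum (comp′ A) + (des word + 1)
      ≡⟨ cong₂ _+_ (trans (cong V.sum comp′≡gaps) (sum-tabulate (suc d) gap))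
                   (sym (sumUpTo-descents S d d≥1 S0 S[1+d] (onto⇒positive d (d≥1 , ≤-refl)))) ⟩
    sumUpTo gap (suc d) + sumUpTo descent (suc d)
      ≡⟨ sumUpTo-+ gap descent (suc d) ⟨
    sumUpTo (λ k → gap k + descent k) (suc d)
      ≡⟨ cong (_+ sumUpTo (λ k → gap k + descent k) (suc d)) Q0 ⟨
    Q 0 + sumUpTo (λ k → gap k + descent k) (suc d)
      ≡⟨ telescope Q _ (suc d) (λ k _ → trans (Q-recurrence k) (+-assoc (Q k) _ _)) ⟨
    Q (suc d)
      ≡⟨ Q[1+d] ⟩
    n ∎
    where open ≡-Reasoning

  lookup-comp′ : ∀ k → lookup (comp′ A) k ≡ gap (toℕ k)
  lookup-comp′ k = trans (cong (λ v → lookup v k) comp′≡gaps) (VP.lookup∘tabulate (λ k → gap (toℕ k)) k)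

  gap-from-comp′ : ∀ k (k≤d : k ≤ d) → lookup (comp′ A) (Fin.fromℕ< (s≤s k≤d)) ≡ gap k
  gap-from-comp′ k k≤d = trans (lookup-comp′ _) (cong gap (FinP.toℕ-fromℕ< (s≤s k≤d)))

  coord≤1+gap : ∀ a → a ≤ d → ∀ k → coord a k ≤ suc (gap k)
  coord≤1+gap a a≤d k = +-cancelʳ-≤ 𝟙[ a < S k ] (coord a k) (suc (gap k)) (begin
    coord a k + 𝟙[ a < S k ]                  ≡⟨ coord-shape a a≤d k ⟩
    gap k + descent k + 𝟙[ a < S (suc k) ]    ≡⟨ +-assoc (gap k) _ _ ⟩
    gap k + (descent k + 𝟙[ a < S (suc k) ])  ≤⟨ +-monoʳ-≤ (gap k) (𝟙[<]-transitive a (S (suc k)) (S k)) ⟩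
    gap k + (1 + 𝟙[ a < S k ])                ≡⟨ +-assoc (gap k) 1 _ ⟨
    gap k + 1 + 𝟙[ a < S k ]                  ≡⟨ cong (_+ 𝟙[ a < S k ]) (+-comm (gap k) 1) ⟩
    suc (gap k) + 𝟙[ a < S k ]                ∎)
    where open ≤-Reasoning

  prefix-antitone : ∀ a → a < d → ∀ u → prefix A (suc a) u ≤ prefix A a u
  prefix-antitone a a<d u = subst₂ _≤_ (sym (shape (suc a) a<d u)) (sym (shape a (<⇒≤ a<d) u))
    (+-monoʳ-≤ (Q u) (𝟙[<]-antitone a (S u)))

  prefix-wrap : ∀ u → prefix A 0 u ≤ suc (prefix A d u)
  prefix-wrap u = subst₂ _≤_ (sym (shape 0 z≤n u)) (cong suc (sym (prefix-last u)))
    (subst (Q u + 𝟙[ 0 < S u ] ≤_) (+-comm (Q u) 1) (+-monoʳ-≤ (Q u) (𝟙[<]≤1 0 (S u))))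

  rows-distinct : ∀ {a b} → a < b → b ≤ d → row A a ≢ row A b
  rows-distinct {a} {b} a<b b≤d e with S-onto b (≤-trans (s≤s z≤n) a<b , b≤d)
  ... | t , _ , S≡ = 1+n≢n (begin
    suc (Q t)       ≡⟨ shape-above (<⇒≤ (<-≤-trans a<b b≤d)) (subst (a <_) (sym S≡) a<b) ⟨
    prefix A a t    ≡⟨ cong (λ v → prefixSum v t) e ⟩
    prefix A b t    ≡⟨ shape-below b≤d (≤-reflexive S≡) ⟩
    Q t             ∎)
    where open ≡-Reasoning

  segSum-≤ : ∀ x y → x ≤ d → y ≤ d → ∀ {u v} → u ≤ v → segSum (row A x) u v ≤ segSum (row A y) u v + 1
  segSum-≤ x y x≤d y≤d {u} {v} u≤v = ∸≤∸+1 (prefix-mono A y u≤v) (begin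
    prefix A x v + prefix A y u                                 ≡⟨ cong₂ _+_ (shape x x≤d v) (shape y y≤d u) ⟩
    Q v + 𝟙[ x < S v ] + (Q u + 𝟙[ y < S u ])                   ≡⟨ interchange (Q v) _ (Q u) _ ⟩
    Q v + Q u + (𝟙[ x < S v ] + 𝟙[ y < S u ])                   ≤⟨ +-monoʳ-≤ (Q v + Q u) (𝟙[<]-exchange x y (S u) (S v)) ⟩
    Q v + Q u + (𝟙[ y < S v ] + 𝟙[ x < S u ] + 1)               ≡⟨ +-assoc (Q v + Q u) _ 1 ⟨
    Q v + Q u + (𝟙[ y < S v ] + 𝟙[ x < S u ]) + 1               ≡⟨ cong (_+ 1) (interchange (Q v) (Q u) _ _) ⟩
    Q v + 𝟙[ y < S v ] + (Q u + 𝟙[ x < S u ]) + 1               ≡⟨ cong₂ (λ p q → p + q + 1) (shape y y≤d v) (shape x x≤d u) ⟨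
    prefix A y v + prefix A x u + 1                             ∎)
    where open ≤-Reasoning

-- Alcoves are staircases

module AlcoveStaircase {d r i : ℕ} (d≥1 : 1 ≤ d) (A : Config d) (alcove : IsAlcove d r i A) where

  private
    in-simplex : ∀ j → InHypersimplex d r i (lookup A j)
    in-simplex = proj₁ (proj₁ alcove)

    distinct : ∀ j l → j ≢ l → lookup A j ≢ lookup A l
    distinct = proj₁ (proj₂ (proj₁ alcove))

  rs : HasRowSums A (i * r)
  rs a a≤d = trans (sym (sum-toList (row A a)))
    (subst (λ v → V.sum v ≡ i * r) (sym (row-lookup A a a≤d)) (proj₂ (in-simplex (Fin.fromℕ< (s≤s a≤d)))))

  Q : ℕ → ℕ
  Q t = prefix A d t

  S : ℕ → ℕ
  S t = sumUpTo (λ a → prefix A a t ∸ prefix A d t) (suc d)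

  shape : ∀ a → a ≤ d → ∀ t → prefix A a t ≡ Q t + 𝟙[ a < S t ]
  shape a a≤d t = column-staircase (λ a → prefix A a t) d
    (λ a a<d → sorted⇒prefix-antitone {r = r} {i} A rs (proj₂ alcove) a a<d t)
    (sorted⇒prefix-wrap {r = r} {i} A rs (proj₂ alcove) t) a a≤d

  S0 : S 0 ≡ 0
  S0 = sumUpTo-vanishing _ (suc d) (λ _ _ → refl)

  S-beyond : ∀ t → suc d ≤ t → S t ≡ 0
  S-beyond t 1+d≤t = sumUpTo-vanishing _ (suc d) λ a a≤d →
    trans (cong₂ _∸_ (prefix-full A rs a (≤-pred a≤d) t 1+d≤t) (prefix-full A rs d ≤-refl t 1+d≤t))
          (n∸n≡0 (i * r))

  S≤d : ∀ t → S t ≤ d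
  S≤d t = 𝟙[<]≡0⇒≥ (+-cancelˡ-≡ (Q t) _ _ (trans (sym (shape d ≤-refl t)) (sym (+-identityʳ (Q t)))))

  S-onto : ∀ y → y ∈[1, d ] → Σ ℕ λ t → t ∈[1, d ] × S t ≡ y
  S-onto (suc a) (_ , 1+a≤d) with anyUpTo? (λ t → S (suc t) ≟ suc a) d
  ... | yes (t , t<d , e) = suc t , (s≤s z≤n , t<d) , e
  ... | no none = ⊥-elim (distinct j j′ j≢j′ (begin
      lookup A j        ≡⟨ row-lookup A a a≤d ⟨
      row A a           ≡⟨ prefix-injective A A a (suc a) same-prefix ⟩
      row A (suc a)     ≡⟨ row-lookup A (suc a) 1+a≤d ⟩
      lookup A j′       ∎))
    where
    open ≡-Reasoning
    a≤d : a ≤ d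
    a≤d = ≤-trans (n≤1+n a) 1+a≤d
    j j′ : Fin (suc d)
    j = Fin.fromℕ< (s≤s a≤d)
    j′ = Fin.fromℕ< (s≤s 1+a≤d)
    j≢j′ : j ≢ j′
    j≢j′ e = 1+n≢n (sym (trans (sym (FinP.toℕ-fromℕ< (s≤s a≤d)))
                               (trans (cong toℕ e) (FinP.toℕ-fromℕ< (s≤s 1+a≤d)))))
    skips : ∀ t → S t ≢ suc a
    skips zero    e = 0≢1+n (trans (sym S0) e)
    skips (suc t) e with t <? d
    ... | yes t<d = none (t , t<d , e)
    ... | no t≮d  = 0≢1+n (trans (sym (S-beyond (suc t) (s≤s (≮⇒≥ t≮d)))) e)
    same-prefix : ∀ t → prefix A a t ≡ prefix A (suc a) t
    same-prefix t = trans (shape a a≤d t)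
      (trans (cong (Q t +_) (𝟙[<]-step a (S t) (skips t))) (sym (shape (suc a) 1+a≤d t)))

  open Staircase d≥1 A rs Q S shape S0 (S-beyond (suc d) ≤-refl) S≤d S-onto public

  coord≤r : ∀ a → a ≤ d → ∀ k → k ≤ d → coord a k ≤ r
  coord≤r a a≤d k k≤d = subst (_≤ r) e (VAllP.lookup⁺ (proj₁ (in-simplex j)) l)
    where
    j l : Fin (suc d)
    j = Fin.fromℕ< (s≤s a≤d)
    l = Fin.fromℕ< (s≤s k≤d)
    e : lookup (lookup A j) l ≡ coord a k
    e = trans (coord-lookup j l) (cong₂ coord (FinP.toℕ-fromℕ< (s≤s a≤d)) (FinP.toℕ-fromℕ< (s≤s k≤d)))

pair-in-codomain : ∀ {d r i} → 1 ≤ d → (A : Config d) → IsAlcove d r i A → InCodomain d r i (pair d r i A)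
pair-in-codomain {d} {r} {i} d≥1 A alcove =
  subst (λ σ → InCodomain d r i (comp′ A , σ)) (sym marks≡word)
    ( des word + 1 , m≤n+m 1 _ , subst (_≤ d) (+-comm 1 _) (des-applyUpTo-< _ d d≥1)
    , (comp′-bounded r coord≤r , sum-comp′+des) , word↭ , refl)
  where open AlcoveStaircase {d} {r} {i} d≥1 A alcove

pair-injective : ∀ {d r i} → 1 ≤ d → (A B : Config d) → IsAlcove d r i A → IsAlcove d r i B →
                 pair d r i A ≡ pair d r i B → A ≡ B
pair-injective {d} {r} {i} d≥1 A B alcove-A alcove-B pair≡ = config-extensionality A B λ a a≤d t → begin
  prefix A a t                ≡⟨ α.shape a a≤d t ⟩
  α.Q t + 𝟙[ a < α.S t ]      ≡⟨ cong₂ (λ q s → q + 𝟙[ a < s ]) (Q≡ t) (S≡ t) ⟩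
  β.Q t + 𝟙[ a < β.S t ]      ≡⟨ β.shape a a≤d t ⟨
  prefix B a t                ∎
  where
  open ≡-Reasoning
  module α = AlcoveStaircase {d} {r} {i} d≥1 A alcove-A
  module β = AlcoveStaircase {d} {r} {i} d≥1 B alcove-B
  S≡ : ∀ t → α.S t ≡ β.S t
  S≡ zero    = trans α.S0 (sym β.S0)
  S≡ (suc t) with t <? d
  ... | yes t<d = begin
    α.S (suc t)       ≡⟨ at-applyUpTo 0 _ d t t<d ⟨
    at 0 α.word t     ≡⟨ cong (λ w → at 0 w t) (trans (sym α.marks≡word) (trans (cong proj₂ pair≡) β.marks≡word)) ⟩
    at 0 β.word t     ≡⟨ at-applyUpTo 0 _ d t t<d ⟩
    β.S (suc t)       ∎
  ... | no t≮d = trans (α.S-beyond (suc t) (s≤s (≮⇒≥ t≮d))) (sym (β.S-beyond (suc t) (s≤s (≮⇒≥ t≮d))))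
  gap≡ : ∀ k → k ≤ d → α.gap k ≡ β.gap k
  gap≡ k k≤d = trans (sym (α.gap-from-comp′ k k≤d))
    (trans (cong (λ c → lookup c (Fin.fromℕ< (s≤s k≤d))) (cong proj₁ pair≡)) (β.gap-from-comp′ k k≤d))
  Q≡ : ∀ t → α.Q t ≡ β.Q t
  Q≡ zero    = refl
  Q≡ (suc k) with k ≤? d
  ... | yes k≤d = begin
    α.Q (suc k)                               ≡⟨ α.Q-recurrence k ⟩
    α.Q k + α.gap k + α.descent k             ≡⟨ cong₂ _+_ (cong₂ _+_ (Q≡ k) (gap≡ k k≤d)) (cong₂ 𝟙[_<_] (S≡ (suc k)) (S≡ k)) ⟩
    β.Q k + β.gap k + β.descent k             ≡⟨ β.Q-recurrence k ⟨
    β.Q (suc k)                               ∎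
  ... | no k≰d = trans (prefix-full A α.rs d ≤-refl (suc k) 1+d≤1+k) (sym (prefix-full B β.rs d ≤-refl (suc k) 1+d≤1+k))
    where
    1+d≤1+k : suc d ≤ suc k
    1+d≤1+k = m≤n⇒m≤1+n (≰⇒> k≰d)

-- The inverse of pair

module Construction {d r i : ℕ} (d≥1 : 1 ≤ d) (r≥1 : 1 ≤ r) (c : Vec ℕ (suc d)) (σ : List ℕ)
  (c≤ : All (_≤ r ∸ 1) c) (σ↭ : σ ↭ L.map suc (upTo d)) (total : V.sum c + (des σ + 1) ≡ i * r) where

  S : ℕ → ℕ
  S zero    = 0
  S (suc t) = at 0 σ t

  Q : ℕ → ℕ
  Q zero    = 0
  Q (suc k) = Q k + at 0 (toList c) k + 𝟙[ S (suc k) < S k ]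

  height : ℕ → ℕ → ℕ
  height a t = Q t + 𝟙[ a < S t ]

  coordinate : ℕ → ℕ → ℕ
  coordinate a k = height a (suc k) ∸ height a k

  rowVec : ℕ → Point d
  rowVec a = tabulate (λ k → coordinate a (toℕ k))

  B : Config d
  B = tabulate (λ a → rowVec (toℕ a))

  length-σ : length σ ≡ d
  length-σ = trans (PermP.↭-length σ↭) (trans (LP.length-map suc (upTo d)) (LP.length-upTo d))

  S-beyond : ∀ t → suc d ≤ t → S t ≡ 0
  S-beyond (suc t) (s≤s d≤t) = at-beyond 0 σ t (subst (_≤ t) (sym length-σ) d≤t)

  S≤d : ∀ t → S t ≤ d
  S≤d zero    = z≤n
  S≤d (suc t) with t <? d
  ... | no t≮d  = ≤-trans (≤-reflexive (S-beyond (suc t) (s≤s (≮⇒≥ t≮d)))) z≤n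
  ... | yes t<d with ∈-map⁻ suc (PermP.∈-resp-↭ σ↭ (at-∈ 0 σ t (subst (t <_) (sym length-σ) t<d)))
  ...   | y , y∈ , e = subst (_≤ d) (sym e) (∈-upTo⁻ y∈)

  S-onto : ∀ y → y ∈[1, d ] → Σ ℕ λ t → t ∈[1, d ] × S t ≡ y
  S-onto (suc y) (_ , y<d) with ∈⇒at 0 σ (PermP.∈-resp-↭ (↭-sym σ↭) (∈-map⁺ suc (∈-upTo⁺ y<d)))
  ... | t , t<len , e = suc t , (s≤s z≤n , subst (t <_) length-σ t<len) , e

  word≡σ : L.applyUpTo (λ t → S (suc t)) d ≡ σ
  word≡σ = trans (cong (L.applyUpTo (at 0 σ)) (sym length-σ)) (applyUpTo-at 0 σ)

  height-step : ∀ a k → height a k ≤ height a (suc k)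
  height-step a k = begin
    Q k + 𝟙[ a < S k ]                                        ≤⟨ +-monoʳ-≤ (Q k) (𝟙[<]-subadditive a (S (suc k)) (S k)) ⟩
    Q k + (𝟙[ S (suc k) < S k ] + 𝟙[ a < S (suc k) ])         ≤⟨ +-monoˡ-≤ _ (m≤m+n (Q k) _) ⟩
    Q k + ck + (𝟙[ S (suc k) < S k ] + 𝟙[ a < S (suc k) ])    ≡⟨ +-assoc (Q k + ck) _ _ ⟨
    Q (suc k) + 𝟙[ a < S (suc k) ]                            ∎
    where
    open ≤-Reasoning
    ck : ℕ
    ck = at 0 (toList c) k

  Q-beyond : ∀ t → suc d ≤ t → Q t ≡ Q (suc d)
  Q-beyond (suc t) (s≤s d≤t) with m≤n⇒m<n∨m≡n d≤t
  ... | inj₂ refl = refl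
  ... | inj₁ d<t  = trans Q-stable (Q-beyond t d<t)
    where
    Q-stable : Q (suc t) ≡ Q t
    Q-stable = trans (cong₂ (λ x y → Q t + x + y)
        (at-beyond 0 (toList c) t (subst (_≤ t) (sym (VP.length-toList c)) d<t))
        (cong₂ 𝟙[_<_] (S-beyond (suc t) (s≤s (<⇒≤ d<t))) (S-beyond t d<t)))
      (trans (+-identityʳ _) (+-identityʳ _))

  row-B : ∀ a → a ≤ d → row B a ≡ rowVec a
  row-B a a≤d = trans (row-lookup B a a≤d)
    (trans (VP.lookup∘tabulate (λ a → rowVec (toℕ a)) (Fin.fromℕ< (s≤s a≤d)))
           (cong rowVec (FinP.toℕ-fromℕ< (s≤s a≤d))))

  shape-≤ : ∀ a → a ≤ d → ∀ t → t ≤ suc d → prefix B a t ≡ height a t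
  shape-≤ a a≤d t t≤1+d = begin
    prefix B a t              ≡⟨ cong (λ v → prefixSum v t) (row-B a a≤d) ⟩
    prefixSum (rowVec a) t    ≡⟨ sum-take-tabulate (suc d) (coordinate a) t t≤1+d ⟩
    sumUpTo (coordinate a) t  ≡⟨ telescope (height a) (coordinate a) t (λ k _ → sym (m+[n∸m]≡n (height-step a k))) ⟨
    height a t                ∎
    where open ≡-Reasoning

  shape : ∀ a → a ≤ d → ∀ t → prefix B a t ≡ height a t
  shape a a≤d t with t ≤? suc d
  ... | yes t≤1+d = shape-≤ a a≤d t t≤1+d
  ... | no  t≰1+d = begin
    prefix B a t          ≡⟨ prefix-beyond B a t 1+d≤t ⟩
    prefix B a (suc d)    ≡⟨ shape-≤ a a≤d (suc d) ≤-refl ⟩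
    height a (suc d)      ≡⟨ cong₂ (λ q s → q + 𝟙[ a < s ]) (Q-beyond t 1+d≤t)
                                    (trans (S-beyond t 1+d≤t) (sym (S-beyond (suc d) ≤-refl))) ⟨
    height a t            ∎
    where
    open ≡-Reasoning
    1+d≤t = <⇒≤ (≰⇒> t≰1+d)

  Q[1+d] : Q (suc d) ≡ i * r
  Q[1+d] = begin
    Q (suc d)
      ≡⟨ telescope Q (λ k → at 0 (toList c) k + 𝟙[ S (suc k) < S k ]) (suc d) (λ k _ → +-assoc (Q k) _ _) ⟩
    sumUpTo (λ k → at 0 (toList c) k + 𝟙[ S (suc k) < S k ]) (suc d)
      ≡⟨ sumUpTo-+ (at 0 (toList c)) (λ k → 𝟙[ S (suc k) < S k ]) (suc d) ⟩
    sumUpTo (at 0 (toList c)) (suc d) + sumUpTo (λ k → 𝟙[ S (suc k) < S k ]) (suc d)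
      ≡⟨ cong₂ _+_ sum-c (sumUpTo-descents S d d≥1 refl (S-beyond (suc d) ≤-refl) S[d]-positive) ⟩
    V.sum c + (des (L.applyUpTo (λ t → S (suc t)) d) + 1)
      ≡⟨ cong (λ w → V.sum c + (des w + 1)) word≡σ ⟩
    V.sum c + (des σ + 1)
      ≡⟨ total ⟩
    i * r ∎
    where
    open ≡-Reasoning
    sum-c : sumUpTo (at 0 (toList c)) (suc d) ≡ V.sum c
    sum-c = trans (sym (sum-take-sumUpTo (toList c) (suc d)))
      (trans (sum-take-all (toList c) (suc d) (≤-reflexive (VP.length-toList c))) (sym (sum-toList c)))
    S[d]-positive : 1 ≤ S d
    S[d]-positive = OntoInterval.onto⇒positive d S S-onto d (d≥1 , ≤-refl)

  rs : HasRowSums B (i * r)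
  rs a a≤d = begin
    NL.sum (toList (row B a))    ≡⟨ sum-take-all (toList (row B a)) (suc d) (≤-reflexive (length-row B a)) ⟨
    prefix B a (suc d)           ≡⟨ shape a a≤d (suc d) ⟩
    Q (suc d) + 𝟙[ a < S (suc d) ] ≡⟨ cong (λ s → Q (suc d) + 𝟙[ a < s ]) (S-beyond (suc d) ≤-refl) ⟩
    Q (suc d) + 0                ≡⟨ +-identityʳ _ ⟩
    Q (suc d)                    ≡⟨ Q[1+d] ⟩
    i * r                        ∎
    where open ≡-Reasoning

  open Staircase d≥1 B rs Q S shape refl (S-beyond (suc d) ≤-refl) S≤d S-onto
    using (descent; gap; comp′≡gaps; lookup-comp′; marks≡word; coord; coord-lookup; coord≤1+gap;
           rows-distinct; segSum-≤; prefix-antitone; prefix-wrap)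

  comp′≡c : comp′ B ≡ c
  comp′≡c = trans comp′≡gaps (trans (VP.tabulate-cong (λ k → trans (gap≡c (toℕ k)) (sym (lookup-at 0 c k))))
                                    (VP.tabulate∘lookup c))
    where
    gap≡c : ∀ k → gap k ≡ at 0 (toList c) k
    gap≡c k = trans (cong (_∸ descent k) (trans (cong (_∸ Q k) (+-assoc (Q k) _ _)) (m+n∸m≡n (Q k) _)))
                    (m+n∸n≡m _ (descent k))

  σ′≡σ : σ′ d r i B ≡ σ
  σ′≡σ = trans marks≡word word≡σ

  B-alcove : IsAlcove d r i B
  B-alcove = (in-simplex , lookup-distinct B rows-distinct , segments)
           , prefix-antitone⇒sorted {r = r} {i} B rs prefix-antitone prefix-wrap
    where
    coord≤r : ∀ j k → lookup (lookup B j) k ≤ r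
    coord≤r j k = begin
      lookup (lookup B j) k         ≡⟨ coord-lookup j k ⟩
      coord (toℕ j) (toℕ k)         ≤⟨ coord≤1+gap (toℕ j) (≤-pred (FinP.toℕ<n j)) (toℕ k) ⟩
      suc (gap (toℕ k))             ≡⟨ cong suc (lookup-comp′ k) ⟨
      suc (lookup (comp′ B) k)      ≡⟨ cong (λ v → suc (lookup v k)) comp′≡c ⟩
      suc (lookup c k)              ≤⟨ s≤s (VAllP.lookup⁺ c≤ k) ⟩
      suc (r ∸ 1)                   ≡⟨ +-comm 1 (r ∸ 1) ⟩
      r ∸ 1 + 1                     ≡⟨ m∸n+n≡m r≥1 ⟩
      r                             ∎
      where open ≤-Reasoning
    in-simplex : ∀ j → InHypersimplex d r i (lookup B j)
    in-simplex j = subst (All (_≤ r)) (VP.tabulate∘lookup (lookup B j)) (VAllP.tabulate⁺ (coord≤r j))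
                 , trans (cong V.sum (lookup-row B j))
                         (trans (sum-toList (row B (toℕ j))) (rs (toℕ j) (≤-pred (FinP.toℕ<n j))))
    segments : ∀ a b → a < b → b ≤ suc d → ∀ j l → segSum (lookup B j) a b ≤ segSum (lookup B l) a b + 1
    segments a b a<b _ j l =
      subst₂ (λ v w → segSum v a b ≤ segSum w a b + 1) (sym (lookup-row B j)) (sym (lookup-row B l))
      (segSum-≤ (toℕ j) (toℕ l) (≤-pred (FinP.toℕ<n j)) (≤-pred (FinP.toℕ<n l)) (<⇒≤ a<b))

pair-surjective : ∀ {d r i} → 1 ≤ d → 1 ≤ r → (y : Vec ℕ (suc d) × List ℕ) → InCodomain d r i y →
                  Σ (Config d) λ A → IsAlcove d r i A × pair d r i A ≡ y
pair-surjective {d} {r} {i} d≥1 r≥1 (c , σ) (_ , _ , _ , (c≤ , total) , σ↭ , des≡) =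
  B , B-alcove , cong₂ _,_ comp′≡c σ′≡σ
  where open Construction {d} {r} {i} d≥1 r≥1 c σ c≤ σ↭ (trans (cong (V.sum c +_) des≡) total)

theorem3p32 : (d r i : ℕ) → 1 ≤ d → 1 ≤ r → 1 ≤ i → i ≤ d →
    ((A : Config d) → IsAlcove d r i A → InCodomain d r i (pair d r i A))
    × ((A B : Config d) → IsAlcove d r i A → IsAlcove d r i B →
         pair d r i A ≡ pair d r i B → A ≡ B)
    × ((y : Vec ℕ (suc d) × List ℕ) → InCodomain d r i y →
         Σ (Config d) λ A → IsAlcove d r i A × pair d r i A ≡ y)
theorem3p32 d r i d≥1 r≥1 _ _ =
  pair-in-codomain {d} {r} {i} d≥1 , pair-injective {d} {r} {i} d≥1 , pair-surjective {d} {r} {i} d≥1 r≥1
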